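{- Let $a$ and $c$ be nonnegative integers with $a+c \ge 1$ and let $b$ be a positive integer. Let $\beta_{a,b,c} \in S_{a+b+c}$ be the permutation $$\beta_{a,b,c} = a+b+c,\ a+b+c-1,\ \ldots,\ b+c+1,\ c+1,\ c+2,\ \ldots,\ b+c,\ c,\ c-1,\ \ldots,\ 2,\ 1.$$ Then for every $n \ge 0$ the restriction of $\mathcal{F}_n$ to $S_n(132, 213, \beta_{a,b,c})$ is a (constructive) bijection between $S_n(132, 213, \beta_{a,b,c})$ and the set of tilings of a $1 \times n$ rectangle by tiles of sizes $1\times i$ ($i \ge 1$) in which every tile, except for the leftmost $a$ tiles and the rightmost $c$ tiles, has length at most $b-1$. In particular, for $n \ge 1$, $$|S_n(132, 213, \beta_{a,b,c})| = \sum_{k=1}^{a+c-1} \binom{n-1}{k-1} + \sum_{k=a+c}^n \binom{k-1}{a+c-1} F_{b-1,n-k+1}.$$ Moreover, $$\sum_{n=0}^\infty |S_n(132, 213, \beta_{a,b,c})| x^n = \frac{(1-x)^{a+c} + x^b \left( \sum_{i=0}^{a+c-1} (1-x)^i x^{a+c-i-1} \right)}{(1-x)^{a+c} (1 - x - x^2 - \cdots - x^{b-1})}.$$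
   Context: $S_n$ is the set of permutations of $\{1,\dots,n\}$ in one-line notation. A permutation $\pi \in S_n$ contains $\sigma \in S_k$ if there are indices $i_1<\cdots<i_k$ such that $\pi(i_s)<\pi(i_t)$ iff $\sigma(s)<\sigma(t)$ for all $s,t$; otherwise $\pi$ avoids $\sigma$. For a set $R$ of permutations, $S_n(R)$ is the set of $\pi\in S_n$ avoiding every element of $R$; $S_0(R)$ consists of the empty permutation only. For integers $k \ge 0$, the $k$-generalized Fibonacci numbers are defined by $F_{k,n}=0$ for $n \le 0$, $F_{k,1}=1$, and $F_{k,n}=\sum_{i=1}^k F_{k,n-i}$ for $n\ge 2$ (so $F_{0,n}=0$ for $n \ge 2$). For $1+x+\dots$ with $b=1$, the denominator $1-x-\cdots-x^{b-1}$ is $1$. Every $\pi \in S_n(132,213)$ ($n\ge1$) can be written as $\pi = r_1, r_1+1, \ldots, n,\ r_2, r_2+1, \ldots, r_1-1,\ \ldots,\ r_m, r_m+1,\ldots, r_{m-1}-1$ for a unique $m \ge 1$ and sequence $n+1=r_0>r_1>\cdots>r_m=1$; $\mathcal{F}_n(\pi)$ is the tiling of a $1\times n$ rectangle whose tiles, read left to right, have lengths $r_0-r_1, r_1-r_2, \ldots, r_{m-1}-r_m$ (and $\mathcal F_0$ sends the empty permutation to the empty tiling). -}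

module Defs where

open import Data.Nat using (ℕ; zero; suc; _+_; _*_; _∸_; _≤_; _<_; _≡ᵇ_)
open import Data.Nat.Combinatorics using (_C_)
open import Data.Integer as ℤ using (ℤ; +_)
open import Data.Bool using (if_then_else_)
open import Data.List using (List; []; _∷_; _++_; length; map; upTo; downFrom; take; lookup)
open import Data.Nat.ListAction using (sum)
open import Data.List.Relation.Unary.All using (All)
open import Data.List.Relation.Unary.Unique.Propositional using (Unique)
open import Data.List.Relation.Binary.Sublist.Propositional using (_⊆_)
open import Data.Fin using (Fin; toℕ; cast)
open import Data.Product using (Σ; ∃; _×_)
open import Function.Bundles using (_⇔_)
open import Relation.Nullary using (¬_)
open import Relation.Binary.PropositionalEquality using (_≡_)

IsPerm : ℕ → List ℕ → Set
IsPerm n π = (length π ≡ n) × Unique π × All (λ x → 1 ≤ x × x ≤ n) π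

OrderIso : List ℕ → List ℕ → Set
OrderIso s σ = Σ (length s ≡ length σ) λ eq →
  (i j : Fin (length s)) →
    (lookup s i < lookup s j) ⇔ (lookup σ (cast eq i) < lookup σ (cast eq j))

Contains : List ℕ → List ℕ → Set
Contains π σ = ∃ λ s → (s ⊆ π) × OrderIso s σ

Avoids : List ℕ → List ℕ → Set
Avoids π σ = ¬ Contains π σ

S : ℕ → List (List ℕ) → List ℕ → Set
S n R π = IsPerm n π × All (Avoids π) R

HasCard : (List ℕ → Set) → ℕ → Set
HasCard P N = ∃ λ (L : List (List ℕ)) →
  Unique L × (∀ π → (π Data.List.Membership.Propositional.∈ L) ⇔ P π) × (length L ≡ N)
  where import Data.List.Membership.Propositional

p132 : List ℕ
p132 = 1 ∷ 3 ∷ 2 ∷ []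

p213 : List ℕ
p213 = 2 ∷ 1 ∷ 3 ∷ []

β : ℕ → ℕ → ℕ → List ℕ
β a b c = map (λ i → b + c + 1 + i) (downFrom a)
       ++ map (λ i → c + 1 + i) (upTo b)
       ++ map suc (downFrom c)

-- Tilings of a 1×n rectangle: list of tile lengths (left to right),
-- each ≥ 1, summing to n.

Tiling : ℕ → List ℕ → Set
Tiling n t = All (λ x → 1 ≤ x) t × (sum t ≡ n)

Restricted : ℕ → ℕ → ℕ → List ℕ → Set
Restricted a b c t = (i : Fin (length t)) → a ≤ toℕ i → toℕ i + c < length t →
  lookup t i ≤ b ∸ 1

-- 𝓕_n: for π = r₁,…,n, r₂,…,r₁-1, …, r_m,…,r_{m-1}-1 ∈ S_n(132,213) the
-- tiles are the lengths of the blocks, i.e. the maximal runs of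
-- consecutive entries increasing by exactly 1.
runsFrom : ℕ → ℕ → List ℕ → List ℕ
runsFrom prev len [] = len ∷ []
runsFrom prev len (y ∷ ys) =
  if y ≡ᵇ suc prev then runsFrom y (suc len) ys else len ∷ runsFrom y 1 ys

𝓕 : List ℕ → List ℕ
𝓕 [] = []
𝓕 (x ∷ xs) = runsFrom x 1 xs

-- k-generalized Fibonacci numbers
-- fibs k n = [F_{k,n}, F_{k,n-1}, …, F_{k,1}]
fibs : ℕ → ℕ → List ℕ
fibs k zero = []
fibs k (suc n) = (if n ≡ᵇ 0 then 1 else sum (take k (fibs k n))) ∷ fibs k n

-- F_{k,n} (= 0 for n = 0)
fib : ℕ → ℕ → ℕ
fib k n with fibs k n
... | [] = 0
... | x ∷ _ = x

-- Σ_{k=lo}^{hi} f k  (empty when hi < lo)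
sumRange : ℕ → ℕ → (ℕ → ℕ) → ℕ
sumRange lo hi f = sum (map (λ i → f (lo + i)) (upTo (suc hi ∸ lo)))

countFormula : ℕ → ℕ → ℕ → ℕ → ℕ
countFormula a b c n =
    sumRange 1 (a + c ∸ 1) (λ k → (n ∸ 1) C (k ∸ 1))
  + sumRange (a + c) n (λ k → ((k ∸ 1) C (a + c ∸ 1)) * fib (b ∸ 1) (n ∸ k + 1))

Series : Set
Series = ℕ → ℤ

sumℤ : List ℤ → ℤ
sumℤ [] = + 0
sumℤ (x ∷ xs) = x ℤ.+ sumℤ xs

_⊕_ : Series → Series → Series
(f ⊕ g) n = f n ℤ.+ g n

_⊛_ : Series → Series → Series
(f ⊛ g) n = sumℤ (map (λ k → f k ℤ.* g (n ∸ k)) (upTo (suc n)))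

𝟙 : Series
𝟙 zero = + 1
𝟙 (suc n) = + 0

X^ : ℕ → Series
X^ m n = if n ≡ᵇ m then + 1 else + 0

oneMinusX : Series
oneMinusX zero = + 1
oneMinusX (suc zero) = ℤ.- (+ 1)
oneMinusX (suc (suc n)) = + 0

_^ˢ_ : Series → ℕ → Series
f ^ˢ zero = 𝟙
f ^ˢ suc m = f ⊛ (f ^ˢ m)

-- 1 - x - x² - ⋯ - x^{b-1}  (= 1 when b = 1)
fibDen : ℕ → Series
fibDen b zero = + 1
fibDen b (suc n) = if suc n Data.Nat.<ᵇ b then ℤ.- (+ 1) else + 0

sumSeries : List Series → Series
sumSeries [] _ = + 0
sumSeries (f ∷ fs) = f ⊕ sumSeries fs

gfNumerator : ℕ → ℕ → ℕ → Series
gfNumerator a b c =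
  (oneMinusX ^ˢ (a + c)) ⊕
  (X^ b ⊛ sumSeries (map (λ i → (oneMinusX ^ˢ i) ⊛ X^ (a + c ∸ i ∸ 1)) (upTo (a + c))))

gfDenominator : ℕ → ℕ → ℕ → Series
gfDenominator a b c = (oneMinusX ^ˢ (a + c)) ⊛ fibDen b

module Submission where

-- A permutation avoiding 132 and 213 is layered: a sequence of blocks of consecutive values, each
-- block increasing and lying above all later blocks, so it is determined by its tiling 𝓕 π. In a
-- layered permutation an increasing subsequence stays within one block and a decreasing one takes
-- at most one entry per block; as β is the skew sum of a decreasing run of length a, an increasing
-- run of length b and a decreasing run of length c, it occurs exactly when some block of length at
-- least b has at least a blocks before it and c after it.
-- A restricted tiling with k < a + c tiles is arbitrary (C(n-1, k-1) of them); otherwise its a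
-- leftmost and c rightmost tiles form a composition of some k into a + c parts and the remaining
-- tiles a tiling of n - k by tiles of length at most b - 1 (F_{b-1, n-k+1} of them). The generating
-- function follows from ∑ C(n-1, k-1) xⁿ = (x / (1 - x))^k and
-- ∑ F_{b-1, m+1} x^m = 1 / (1 - x - ⋯ - x^{b-1}).

module LayeredPermutations where
  open import Defs
  open import Data.Bool using (true; false)
  open import Data.Empty using (⊥; ⊥-elim)
  open import Data.Fin using (Fin; zero; suc; toℕ; cast)
  open import Data.Fin.Properties using (toℕ-injective; toℕ-cast)
  open import Data.List
    using (List; []; _∷_; _++_; length; lookup; map; concatMap; take; drop; upTo; applyUpTo; applyDownFrom)
  open import Data.List.Properties
    using ( ∷-injectiveˡ; ∷-injectiveʳ; ++-assoc; ++-identityʳ; ++-cancelˡ; ++-cancelʳ; take++drop≡id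
          ; length-++; length-map; length-take; length-drop; length-applyDownFrom
          ; map-cong; map-upTo; map-downFrom; map-applyUpTo)
  open import Data.List.Membership.Propositional using (_∈_; find; lose)
  open import Data.List.Membership.Propositional.Properties
    using ( ∈-∃++; ∈-++⁺ˡ; ∈-++⁺ʳ; ∈-++⁻; ∈-map⁺; ∈-map⁻; ∈-concatMap⁺; ∈-concatMap⁻
          ; ∈-applyUpTo⁺; ∈-applyUpTo⁻)
  open import Data.List.Relation.Binary.Equality.Propositional using (≋⇒≡)
  open import Data.List.Relation.Binary.Pointwise as Pointwise using (Pointwise; []; _∷_)
  open import Data.List.Relation.Binary.Sublist.Propositional
    using (_⊆_; []; _∷_; _∷ʳ_; minimum; ⊆-refl; ⊆-trans; from∈)
  open import Data.List.Relation.Binary.Sublist.Propositional.Properties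
    using (All-resp-⊆; ++⁺ˡ; ++⁺ʳ; length-mono-≤; to-≋) renaming (++⁺ to ⊆-++⁺)
  open import Data.List.Relation.Unary.All as All using (All; []; _∷_)
  open import Data.List.Relation.Unary.All.Properties using (++⁺; ++⁻ˡ; ++⁻ʳ; take⁺; drop⁺; applyDownFrom⁺₁)
  open import Data.List.Relation.Unary.AllPairs as AllPairs using (AllPairs; []; _∷_)
  import Data.List.Relation.Unary.AllPairs.Properties as AllPairs
  open import Data.List.Relation.Unary.Any using (here; there)
  open import Data.List.Relation.Unary.Unique.Propositional using (Unique)
  import Data.List.Relation.Unary.Unique.Propositional.Properties as Unique
  open import Data.Nat
  open import Data.Nat.Combinatorics using (_C_; nCk+nC[k+1]≡[n+1]C[k+1])
  open import Data.Nat.Induction using (<-wellFounded)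
  open import Data.Nat.ListAction using (sum)
  open import Data.Nat.ListAction.Properties using (sum-++)
  open import Data.Nat.Properties
  open import Data.Product using (∃; ∃₂; _×_; _,_; proj₁; proj₂; swap)
  open import Data.Sum as Sum using (_⊎_; inj₁; inj₂)
  open import Data.Unit using (⊤; tt)
  open import Function.Base using (_∘_)
  open import Function.Bundles using (_⇔_; mk⇔; Equivalence)
  open import Function.Properties.Equivalence using () renaming (trans to ⇔-trans)
  open import Induction.WellFounded using (Acc; acc)
  open import Relation.Binary.Definitions using (tri<; tri≈; tri>)
  open import Relation.Binary.PropositionalEquality
  open import Relation.Nullary using (¬_; yes; no)

  ⊆-++⁻ : ∀ {A : Set} (u : List A) {w s : List A} → s ⊆ u ++ w →
    ∃₂ λ s₁ s₂ → s ≡ s₁ ++ s₂ × s₁ ⊆ u × s₂ ⊆ w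
  ⊆-++⁻ [] p = [] , _ , refl , [] , p
  ⊆-++⁻ (x ∷ u) (.x ∷ʳ p) with ⊆-++⁻ u p
  ... | s₁ , s₂ , refl , p₁ , p₂ = s₁ , s₂ , refl , x ∷ʳ p₁ , p₂
  ⊆-++⁻ (x ∷ u) (refl ∷ p) with ⊆-++⁻ u p
  ... | s₁ , s₂ , refl , p₁ , p₂ = x ∷ s₁ , s₂ , refl , refl ∷ p₁ , p₂

  AllPairs-resp-⊆ : ∀ {A : Set} {R : A → A → Set} {s xs : List A} →
    s ⊆ xs → AllPairs R xs → AllPairs R s
  AllPairs-resp-⊆ [] [] = []
  AllPairs-resp-⊆ (_ ∷ʳ p) (_ ∷ rs) = AllPairs-resp-⊆ p rs
  AllPairs-resp-⊆ (refl ∷ p) (r ∷ rs) = All-resp-⊆ p r ∷ AllPairs-resp-⊆ p rs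

  Unique-++⁻ʳ : ∀ {A : Set} (xs : List A) {ys : List A} → Unique (xs ++ ys) → Unique ys
  Unique-++⁻ʳ [] u = u
  Unique-++⁻ʳ (x ∷ xs) (_ ∷ u) = Unique-++⁻ʳ xs u

  Unique⇒length≤ : ∀ {A : Set} {xs ys : List A} → Unique xs → All (_∈ ys) xs → length xs ≤ length ys
  Unique⇒length≤ {xs = []} _ _ = z≤n
  Unique⇒length≤ {xs = x ∷ xs} (x∉xs ∷ u) (x∈ys ∷ xs⊆ys) with ∈-∃++ x∈ys
  ... | ys₁ , ys₂ , refl = begin
    suc (length xs)                 ≤⟨ s≤s (Unique⇒length≤ u (All.zipWith remove (x∉xs , xs⊆ys))) ⟩
    suc (length (ys₁ ++ ys₂))       ≡⟨ cong suc (length-++ ys₁) ⟩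
    suc (length ys₁ + length ys₂)   ≡⟨ sym (+-suc (length ys₁) (length ys₂)) ⟩
    length ys₁ + length (x ∷ ys₂)   ≡⟨ sym (length-++ ys₁) ⟩
    length (ys₁ ++ x ∷ ys₂)         ∎
    where
    open ≤-Reasoning
    remove : ∀ {y} → x ≢ y × y ∈ ys₁ ++ x ∷ ys₂ → y ∈ ys₁ ++ ys₂
    remove (x≢y , y∈) with ∈-++⁻ ys₁ y∈
    ... | inj₁ y∈ys₁ = ∈-++⁺ˡ y∈ys₁
    ... | inj₂ (here refl) = ⊥-elim (x≢y refl)
    ... | inj₂ (there y∈ys₂) = ∈-++⁺ʳ ys₁ y∈ys₂

  take-length-++ : {A : Set} (xs : List A) {ys : List A} → take (length xs) (xs ++ ys) ≡ xs
  take-length-++ [] = refl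
  take-length-++ (x ∷ xs) = cong (x ∷_) (take-length-++ xs)

  drop-length-++ : {A : Set} (xs : List A) {ys : List A} → drop (length xs) (xs ++ ys) ≡ ys
  drop-length-++ [] = refl
  drop-length-++ (x ∷ xs) = drop-length-++ xs

  splitAt-length : {A : Set} (k : ℕ) (xs : List A) → k ≤ length xs →
    ∃₂ λ ys zs → xs ≡ ys ++ zs × length ys ≡ k
  splitAt-length zero xs _ = [] , xs , refl , refl
  splitAt-length (suc k) (x ∷ xs) (s≤s k≤xs) =
    let ys , zs , xs≡ , |ys|≡k = splitAt-length k xs k≤xs in x ∷ ys , zs , cong (x ∷_) xs≡ , cong suc |ys|≡k

  length-concatMap : {A B : Set} (f : A → List B) (xs : List A) →
    length (concatMap f xs) ≡ sum (map (length ∘ f) xs)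
  length-concatMap f [] = refl
  length-concatMap f (x ∷ xs) = trans (length-++ (f x)) (cong (length (f x) +_) (length-concatMap f xs))

  applyUpTo-cong : {A : Set} {f g : ℕ → A} → (∀ i → f i ≡ g i) → (n : ℕ) → applyUpTo f n ≡ applyUpTo g n
  applyUpTo-cong f≗g zero = refl
  applyUpTo-cong f≗g (suc n) = cong₂ _∷_ (f≗g 0) (applyUpTo-cong (f≗g ∘ suc) n)

  sum-map-const : {A : Set} (m : ℕ) (xs : List A) → sum (map (λ _ → m) xs) ≡ length xs * m
  sum-map-const m [] = refl
  sum-map-const m (x ∷ xs) = cong (m +_) (sum-map-const m xs)

  length≤sum : {t : List ℕ} → All (1 ≤_) t → length t ≤ sum t
  length≤sum [] = z≤n
  length≤sum (1≤x ∷ t⁺) = +-mono-≤ 1≤x (length≤sum t⁺)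

  +-≤-≡⇒≡ : {a b c d : ℕ} → a ≤ c → b ≤ d → a + b ≡ c + d → a ≡ c × b ≡ d
  +-≤-≡⇒≡ {a} {b} {c} {d} a≤c b≤d a+b≡c+d = a≡c , +-cancelˡ-≡ a b d (trans a+b≡c+d (cong (_+ d) (sym a≡c)))
    where
    a≡c : a ≡ c
    a≡c = ≤-antisym a≤c (+-cancelʳ-≤ d c a (≤-trans (≤-reflexive (sym a+b≡c+d)) (+-monoʳ-≤ a b≤d)))

  <∸⇒+< : (d : ℕ) {i m : ℕ} → i < m ∸ d → d + i < m
  <∸⇒+< zero i<m = i<m
  <∸⇒+< (suc d) {m = suc m} i<m∸d = s≤s (<∸⇒+< d i<m∸d)

  nC0≡1 : (n : ℕ) → n C 0 ≡ 1
  nC0≡1 zero = refl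
  nC0≡1 (suc n) = refl

  Increasing : List ℕ → Set
  Increasing = AllPairs _<_

  Decreasing : List ℕ → Set
  Decreasing = AllPairs _>_

  Above : List ℕ → List ℕ → Set
  Above xs ys = All (λ x → All (_< x) ys) xs

  -- Layered permutations

  block : ℕ → ℕ → List ℕ
  block s zero = []
  block s (suc l) = suc s ∷ block (suc s) l

  -- The permutation π with 𝓕 π ≡ t: its leftmost tile l carries the l largest values.
  layered : List ℕ → List ℕ
  layered [] = []
  layered (l ∷ t) = block (sum t) l ++ layered t

  length-block : (s l : ℕ) → length (block s l) ≡ l
  length-block s zero = refl
  length-block s (suc l) = cong suc (length-block (suc s) l)

  block-bounds : (s l : ℕ) → All (λ x → s < x × x ≤ s + l) (block s l)
  block-bounds s zero = []
  block-bounds s (suc l) rewrite +-suc s l =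
    (≤-refl , s≤s (m≤m+n s l)) ∷ All.map (λ (p , q) → <⇒≤ p , q) (block-bounds (suc s) l)

  block-increasing : (s l : ℕ) → Increasing (block s l)
  block-increasing s zero = []
  block-increasing s (suc l) =
    All.map proj₁ (block-bounds (suc s) l) ∷ block-increasing (suc s) l

  block-⊆ : (s : ℕ) {k l : ℕ} → k ≤ l → block s k ⊆ block s l
  block-⊆ s {zero} _ = minimum _
  block-⊆ s {suc k} (s≤s k≤l) = refl ∷ block-⊆ (suc s) k≤l

  length-layered : (t : List ℕ) → length (layered t) ≡ sum t
  length-layered [] = refl
  length-layered (l ∷ t) = begin
    length (block (sum t) l ++ layered t)   ≡⟨ length-++ (block (sum t) l) ⟩
    length (block (sum t) l) + length (layered t)
      ≡⟨ cong₂ _+_ (length-block (sum t) l) (length-layered t) ⟩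
    l + sum t                               ∎
    where open ≡-Reasoning

  layered-bounds : (t : List ℕ) → All (λ x → 1 ≤ x × x ≤ sum t) (layered t)
  layered-bounds [] = []
  layered-bounds (l ∷ t) = ++⁺
    (All.map (λ (p , q) → ≤-trans (s≤s z≤n) p , ≤-trans q (≤-reflexive (+-comm (sum t) l)))
      (block-bounds (sum t) l))
    (All.map (λ (p , q) → p , ≤-trans q (m≤n+m (sum t) l)) (layered-bounds t))

  layered-unique : (t : List ℕ) → Unique (layered t)
  layered-unique [] = []
  layered-unique (l ∷ t) = Unique.++⁺
    (AllPairs.map <⇒≢ (block-increasing (sum t) l))
    (layered-unique t)
    (λ (x∈block , x∈rest) → <⇒≱ (proj₁ (All.lookup (block-bounds (sum t) l) x∈block))
                                 (proj₂ (All.lookup (layered-bounds t) x∈rest)))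

  layered-isPerm : (t : List ℕ) → IsPerm (sum t) (layered t)
  layered-isPerm t = length-layered t , layered-unique t , layered-bounds t

  layered-suffix : (u w : List ℕ) → layered w ⊆ layered (u ++ w)
  layered-suffix [] w = ⊆-refl
  layered-suffix (l ∷ u) w = ++⁺ˡ (block (sum (u ++ w)) l) (layered-suffix u w)

  ≡ᵇ-refl : (m : ℕ) → (m ≡ᵇ m) ≡ true
  ≡ᵇ-refl zero = refl
  ≡ᵇ-refl (suc m) = ≡ᵇ-refl m

  <⇒≡ᵇ≡false : {m n : ℕ} → m < n → (m ≡ᵇ n) ≡ false
  <⇒≡ᵇ≡false {zero} (s≤s _) = refl
  <⇒≡ᵇ≡false {suc m} (s≤s m<n) = <⇒≡ᵇ≡false m<n

  runsFrom-block : (p len k : ℕ) (xs : List ℕ) →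
    runsFrom p len (block p k ++ xs) ≡ runsFrom (p + k) (len + k) xs
  runsFrom-block p len zero xs rewrite +-identityʳ p | +-identityʳ len = refl
  runsFrom-block p len (suc k) xs rewrite ≡ᵇ-refl p | +-suc p k | +-suc len k =
    runsFrom-block (suc p) (suc len) k xs

  runsFrom-break : {p len : ℕ} (y : ℕ) (ys : List ℕ) → (y ≡ᵇ suc p) ≡ false →
    runsFrom p len (y ∷ ys) ≡ len ∷ runsFrom y 1 ys
  runsFrom-break y ys y≢p+1 rewrite y≢p+1 = refl

  𝓕-layered : (t : List ℕ) → All (1 ≤_) t → 𝓕 (layered t) ≡ t

  runsFrom-layered : (p len : ℕ) (t : List ℕ) → All (1 ≤_) t → sum t ≤ p →
    runsFrom p len (layered t) ≡ len ∷ t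
  runsFrom-layered p len [] _ _ = refl
  runsFrom-layered p len (suc l ∷ t) t⁺@(_ ∷ _) l+t≤p =
    trans (runsFrom-break (suc (sum t)) (block (suc (sum t)) l ++ layered t) (<⇒≡ᵇ≡false t<p))
          (cong (len ∷_) (𝓕-layered (suc l ∷ t) t⁺))
    where
    t<p : sum t < p
    t<p = ≤-trans (s≤s (m≤n+m (sum t) l)) l+t≤p

  𝓕-layered [] _ = refl
  𝓕-layered (suc l ∷ t) (_ ∷ t⁺) = trans (runsFrom-block (suc (sum t)) 1 l (layered t))
    (runsFrom-layered (suc (sum t) + l) (suc l) t t⁺ (≤-trans (n≤1+n (sum t)) (m≤m+n _ l)))

  layered-injective : {t t′ : List ℕ} → All (1 ≤_) t → All (1 ≤_) t′ → layered t ≡ layered t′ → t ≡ t′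
  layered-injective {t} {t′} t⁺ t′⁺ layered≡ =
    trans (sym (𝓕-layered t t⁺)) (trans (cong 𝓕 layered≡) (𝓕-layered t′ t′⁺))

  ∈-block : {s l y : ℕ} → s < y → y ≤ s + l → y ∈ block s l
  ∈-block {s} {zero} s<y y≤s = ⊥-elim (<⇒≱ s<y (≤-trans y≤s (≤-reflexive (+-identityʳ s))))
  ∈-block {s} {suc l} s<y y≤s+l with m≤n⇒m<n∨m≡n s<y
  ... | inj₂ refl = here refl
  ... | inj₁ s+1<y = there (∈-block s+1<y (≤-trans y≤s+l (≤-reflexive (+-suc s l))))

  Increasing⇒⊆block : (lo k : ℕ) {xs : List ℕ} → Increasing xs →
    All (λ y → lo < y × y ≤ lo + k) xs → xs ⊆ block lo k
  Increasing⇒⊆block lo k {[]} _ _ = minimum _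
  Increasing⇒⊆block lo zero {x ∷ _} _ ((lo<x , x≤lo) ∷ _) =
    ⊥-elim (<⇒≱ lo<x (≤-trans x≤lo (≤-reflexive (+-identityʳ lo))))
  Increasing⇒⊆block lo (suc k) {x ∷ xs} (x<xs ∷ inc) ((lo<x , x≤) ∷ bounds)
    with m≤n⇒m<n∨m≡n lo<x
  ... | inj₂ refl = refl ∷ Increasing⇒⊆block (suc lo) k inc
    (All.zipWith (λ (x<y , (_ , y≤)) → x<y , ≤-trans y≤ (≤-reflexive (+-suc lo k))) (x<xs , bounds))
  ... | inj₁ lo+1<x = suc lo ∷ʳ Increasing⇒⊆block (suc lo) k (x<xs ∷ inc)
    ((lo+1<x , ≤-trans x≤ (≤-reflexive (+-suc lo k))) ∷
     All.zipWith (λ (x<y , (_ , y≤)) → <-trans lo+1<x x<y , ≤-trans y≤ (≤-reflexive (+-suc lo k)))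
                 (x<xs , bounds))

  SameOrder : ℕ → ℕ → ℕ → ℕ → Set
  SameOrder x u y v = (x < y ⇔ u < v) × (y < x ⇔ v < u)

  sameOrder-< : {x u y v : ℕ} → x < y → u < v → SameOrder x u y v
  sameOrder-< x<y u<v = mk⇔ (λ _ → u<v) (λ _ → x<y) , mk⇔ (λ y<x → ⊥-elim (<-asym x<y y<x))
                                                        (λ v<u → ⊥-elim (<-asym u<v v<u))

  sameOrder-> : {x u y v : ℕ} → y < x → v < u → SameOrder x u y v
  sameOrder-> y<x v<u = swap (sameOrder-< y<x v<u)

  infix 4 _≅_

  -- OrderIso, recursively: the head of s compares with each later entry as the head of σ does.
  data _≅_ : List ℕ → List ℕ → Set where
    [] : [] ≅ []
    _∷_ : {x u : ℕ} {s σ : List ℕ} →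
          Pointwise (SameOrder x u) s σ → s ≅ σ → x ∷ s ≅ u ∷ σ

  ≅-length : {s σ : List ℕ} → s ≅ σ → length s ≡ length σ
  ≅-length [] = refl
  ≅-length (_ ∷ s≅σ) = cong suc (≅-length s≅σ)

  ≅⇒OrderIso : {s σ : List ℕ} → s ≅ σ → OrderIso s σ
  ≅⇒OrderIso s≅σ = ≅-length s≅σ , ≅-lookup s≅σ _
    where
    ≅-lookup : {s σ : List ℕ} → s ≅ σ → .(e : length s ≡ length σ) → (i j : Fin (length s)) →
      (lookup s i < lookup s j) ⇔ (lookup σ (cast e i) < lookup σ (cast e j))
    ≅-lookup (_ ∷ _) e zero zero = mk⇔ (λ x<x → ⊥-elim (<-irrefl refl x<x))
                                       (λ u<u → ⊥-elim (<-irrefl refl u<u))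
    ≅-lookup (ps ∷ _) e zero (suc j) = proj₁ (Pointwise.lookup⁺ ps j)
    ≅-lookup (ps ∷ _) e (suc i) zero = proj₂ (Pointwise.lookup⁺ ps i)
    ≅-lookup (_ ∷ s≅σ) e (suc i) (suc j) = ≅-lookup s≅σ (cong pred e) i j

  OrderIso⇒≅ : {s σ : List ℕ} → OrderIso s σ → s ≅ σ
  OrderIso⇒≅ {[]} {[]} _ = []
  OrderIso⇒≅ {x ∷ s} {u ∷ σ} (e , iso) =
    Pointwise.lookup⁻ e′ sameOrder ∷ OrderIso⇒≅ (e′ , λ i j → iso (suc i) (suc j))
    where
    e′ : length s ≡ length σ
    e′ = suc-injective e
    sameOrder : {i : Fin (length s)} {j : Fin (length σ)} → toℕ i ≡ toℕ j →
      SameOrder x u (lookup s i) (lookup σ j)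
    sameOrder {i} {j} i≡j rewrite toℕ-injective (trans (sym i≡j) (sym (toℕ-cast e′ i))) =
      iso zero (suc i) , iso (suc i) zero

  above-pointwise : {x u : ℕ} {s σ : List ℕ} → All (_< x) s → All (_< u) σ →
    length s ≡ length σ → Pointwise (SameOrder x u) s σ
  above-pointwise {s = []} {[]} _ _ _ = []
  above-pointwise {s = _ ∷ _} {_ ∷ _} (y<x ∷ s<x) (v<u ∷ σ<u) e =
    sameOrder-> y<x v<u ∷ above-pointwise s<x σ<u (suc-injective e)

  below-pointwise : {x u : ℕ} {s σ : List ℕ} → All (x <_) s → All (u <_) σ →
    length s ≡ length σ → Pointwise (SameOrder x u) s σ
  below-pointwise {s = []} {[]} _ _ _ = []
  below-pointwise {s = _ ∷ _} {_ ∷ _} (x<y ∷ x<s) (u<v ∷ u<σ) e =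
    sameOrder-< x<y u<v ∷ below-pointwise x<s u<σ (suc-injective e)

  Increasing-≅ : {s σ : List ℕ} → Increasing s → Increasing σ → length s ≡ length σ → s ≅ σ
  Increasing-≅ {[]} {[]} _ _ _ = []
  Increasing-≅ {_ ∷ _} {_ ∷ _} (x<s ∷ s-inc) (u<σ ∷ σ-inc) e =
    below-pointwise x<s u<σ (suc-injective e) ∷ Increasing-≅ s-inc σ-inc (suc-injective e)

  ≅-++⁺ : {s₁ s₂ σ₁ σ₂ : List ℕ} → s₁ ≅ σ₁ → s₂ ≅ σ₂ → Above s₁ s₂ → Above σ₁ σ₂ →
    s₁ ++ s₂ ≅ σ₁ ++ σ₂
  ≅-++⁺ [] s₂≅σ₂ _ _ = s₂≅σ₂
  ≅-++⁺ (ps ∷ s₁≅σ₁) s₂≅σ₂ (s₂<x ∷ s₁>s₂) (σ₂<u ∷ σ₁>σ₂) =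
    Pointwise.++⁺ ps (above-pointwise s₂<x σ₂<u (≅-length s₂≅σ₂)) ∷ ≅-++⁺ s₁≅σ₁ s₂≅σ₂ s₁>s₂ σ₁>σ₂

  Contains≅ : List ℕ → List ℕ → Set
  Contains≅ π σ = ∃ λ s → s ⊆ π × s ≅ σ

  Contains⇔Contains≅ : {π σ : List ℕ} → Contains π σ ⇔ Contains≅ π σ
  Contains⇔Contains≅ = mk⇔ (λ (s , s⊆π , iso) → s , s⊆π , OrderIso⇒≅ iso)
                          (λ (s , s⊆π , s≅σ) → s , s⊆π , ≅⇒OrderIso s≅σ)

  Contains-132⇔ : {π : List ℕ} →
    Contains π p132 ⇔ (∃₂ λ x y → ∃ λ z → x ∷ y ∷ z ∷ [] ⊆ π × x < z × z < y)
  Contains-132⇔ {π} = mk⇔ toOccurrence fromOccurrence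
    where
    toOccurrence : Contains π p132 → ∃₂ λ x y → ∃ λ z → x ∷ y ∷ z ∷ [] ⊆ π × x < z × z < y
    toOccurrence c with Equivalence.to Contains⇔Contains≅ c
    ... | x ∷ y ∷ z ∷ [] , s⊆π , ((_ ∷ xz ∷ []) ∷ (zy ∷ []) ∷ [] ∷ []) =
      x , y , z , s⊆π , Equivalence.from (proj₁ xz) (s≤s (s≤s z≤n)) ,
                        Equivalence.from (proj₂ zy) (s≤s (s≤s (s≤s z≤n)))
    fromOccurrence : (∃₂ λ x y → ∃ λ z → x ∷ y ∷ z ∷ [] ⊆ π × x < z × z < y) → Contains π p132
    fromOccurrence (x , y , z , s⊆π , x<z , z<y) = Equivalence.from Contains⇔Contains≅
      (_ , s⊆π , (sameOrder-< (<-trans x<z z<y) (s≤s (s≤s z≤n)) ∷ sameOrder-< x<z (s≤s (s≤s z≤n)) ∷ [])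
               ∷ (sameOrder-> z<y (s≤s (s≤s (s≤s z≤n))) ∷ []) ∷ [] ∷ [])

  Contains-213⇔ : {π : List ℕ} →
    Contains π p213 ⇔ (∃₂ λ x y → ∃ λ z → x ∷ y ∷ z ∷ [] ⊆ π × y < x × x < z)
  Contains-213⇔ {π} = mk⇔ toOccurrence fromOccurrence
    where
    toOccurrence : Contains π p213 → ∃₂ λ x y → ∃ λ z → x ∷ y ∷ z ∷ [] ⊆ π × y < x × x < z
    toOccurrence c with Equivalence.to Contains⇔Contains≅ c
    ... | x ∷ y ∷ z ∷ [] , s⊆π , ((yx ∷ xz ∷ []) ∷ _ ∷ [] ∷ []) =
      x , y , z , s⊆π , Equivalence.from (proj₂ yx) (s≤s (s≤s z≤n)) ,
                        Equivalence.from (proj₁ xz) (s≤s (s≤s (s≤s z≤n)))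
    fromOccurrence : (∃₂ λ x y → ∃ λ z → x ∷ y ∷ z ∷ [] ⊆ π × y < x × x < z) → Contains π p213
    fromOccurrence (x , y , z , s⊆π , y<x , x<z) = Equivalence.from Contains⇔Contains≅
      (_ , s⊆π , (sameOrder-> y<x (s≤s (s≤s z≤n)) ∷ sameOrder-< x<z (s≤s (s≤s (s≤s z≤n))) ∷ [])
               ∷ (sameOrder-< (<-trans y<x x<z) (s≤s (s≤s z≤n)) ∷ []) ∷ [] ∷ [])

  Avoids-resp-⊆ : {s π σ : List ℕ} → s ⊆ π → Avoids π σ → Avoids s σ
  Avoids-resp-⊆ s⊆π π-avoids (u , u⊆s , u≅σ) = π-avoids (u , ⊆-trans u⊆s s⊆π , u≅σ)

  -- Avoiding 132 and 213

  layered-⊆⁻ : (l : ℕ) (t : List ℕ) {s : List ℕ} → s ⊆ layered (l ∷ t) →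
    ∃₂ λ s₁ s₂ → s ≡ s₁ ++ s₂ × length s₁ ≤ l × Increasing s₁ × Above s₁ s₂ × s₂ ⊆ layered t
  layered-⊆⁻ l t s⊆ with ⊆-++⁻ (block (sum t) l) s⊆
  ... | s₁ , s₂ , refl , s₁⊆ , s₂⊆ =
    s₁ , s₂ , refl , ≤-trans (length-mono-≤ s₁⊆) (≤-reflexive (length-block (sum t) l)) ,
    AllPairs-resp-⊆ s₁⊆ (block-increasing (sum t) l) ,
    All.map (λ (t<x , _) → All.map (λ (_ , y≤t) → ≤-<-trans y≤t t<x)
                                   (All-resp-⊆ s₂⊆ (layered-bounds t)))
            (All-resp-⊆ s₁⊆ (block-bounds (sum t) l)) ,
    s₂⊆

  layered-avoids-132 : (t : List ℕ) → Avoids (layered t) p132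
  layered-avoids-132 t c with Equivalence.to Contains-132⇔ c
  ... | _ , _ , _ , s⊆ , x<z , z<y = no132 t s⊆ x<z z<y
    where
    no132 : (t : List ℕ) {x y z : ℕ} → x ∷ y ∷ z ∷ [] ⊆ layered t → x < z → z < y → ⊥
    no132 (l ∷ t) s⊆ x<z z<y with layered-⊆⁻ l t s⊆
    ... | [] , _ , refl , _ , _ , _ , s₂⊆ = no132 t s₂⊆ x<z z<y
    ... | _ ∷ [] , _ , refl , _ , _ , (y<x ∷ _) ∷ [] , _ = <-asym (<-trans x<z z<y) y<x
    ... | _ ∷ _ ∷ [] , _ , refl , _ , _ , (z<x ∷ []) ∷ _ , _ = <-asym x<z z<x
    ... | _ ∷ _ ∷ _ ∷ [] , _ , refl , _ , _ ∷ (y<z ∷ []) ∷ _ , _ , _ = <-asym y<z z<y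
    ... | _ ∷ _ ∷ _ ∷ _ ∷ _ , _ , () , _

  layered-avoids-213 : (t : List ℕ) → Avoids (layered t) p213
  layered-avoids-213 t c with Equivalence.to Contains-213⇔ c
  ... | _ , _ , _ , s⊆ , y<x , x<z = no213 t s⊆ y<x x<z
    where
    no213 : (t : List ℕ) {x y z : ℕ} → x ∷ y ∷ z ∷ [] ⊆ layered t → y < x → x < z → ⊥
    no213 (l ∷ t) s⊆ y<x x<z with layered-⊆⁻ l t s⊆
    ... | [] , _ , refl , _ , _ , _ , s₂⊆ = no213 t s₂⊆ y<x x<z
    ... | _ ∷ [] , _ , refl , _ , _ , (_ ∷ z<x ∷ []) ∷ [] , _ = <-asym x<z z<x
    ... | _ ∷ _ ∷ [] , _ , refl , _ , (x<y ∷ []) ∷ _ , _ , _ = <-asym x<y y<x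
    ... | _ ∷ _ ∷ _ ∷ [] , _ , refl , _ , (x<y ∷ _) ∷ _ , _ , _ = <-asym x<y y<x
    ... | _ ∷ _ ∷ _ ∷ _ ∷ _ , _ , () , _

  -- After the first entry r, an avoider lists the larger entries
  -- increasingly (no 132) and all of them before the smaller ones (no 213).
  avoider-split : (r : ℕ) (ρ : List ℕ) → Unique ρ → All (r ≢_) ρ →
    Avoids (r ∷ ρ) p132 → Avoids (r ∷ ρ) p213 →
    ∃₂ λ ρ₁ ρ₂ → ρ ≡ ρ₁ ++ ρ₂ × All (r <_) ρ₁ × Increasing ρ₁ × All (_< r) ρ₂
  avoider-split r [] _ _ _ _ = [] , [] , refl , [] , [] , []
  avoider-split r (y ∷ ρ) (y∉ρ ∷ ρ-unique) (r≢y ∷ r∉ρ) av132 av213 with <-cmp y r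
  ... | tri≈ _ y≡r _ = ⊥-elim (r≢y (sym y≡r))
  ... | tri< y<r _ _ = [] , y ∷ ρ , refl , [] , [] , y<r ∷ All.tabulate below
    where
    below : ∀ {z} → z ∈ ρ → z < r
    below {z} z∈ρ with <-cmp z r
    ... | tri< z<r _ _ = z<r
    ... | tri≈ _ z≡r _ = ⊥-elim (All.lookup r∉ρ z∈ρ (sym z≡r))
    ... | tri> _ _ r<z = ⊥-elim (av213 (Equivalence.from Contains-213⇔
                                         (r , y , z , refl ∷ refl ∷ from∈ z∈ρ , y<r , r<z)))
  ... | tri> _ _ r<y
    with avoider-split r ρ ρ-unique r∉ρ (Avoids-resp-⊆ (refl ∷ y ∷ʳ ⊆-refl) av132)
                                        (Avoids-resp-⊆ (refl ∷ y ∷ʳ ⊆-refl) av213)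
  ... | ρ₁ , ρ₂ , refl , r<ρ₁ , ρ₁-inc , ρ₂<r =
    y ∷ ρ₁ , ρ₂ , refl , r<y ∷ r<ρ₁ , All.tabulate above ∷ ρ₁-inc , ρ₂<r
    where
    above : ∀ {z} → z ∈ ρ₁ → y < z
    above {z} z∈ρ₁ with <-cmp y z
    ... | tri< y<z _ _ = y<z
    ... | tri≈ _ y≡z _ = ⊥-elim (All.lookup y∉ρ (∈-++⁺ˡ z∈ρ₁) y≡z)
    ... | tri> _ _ z<y = ⊥-elim (av132 (Equivalence.from Contains-132⇔
      (r , y , z , refl ∷ refl ∷ from∈ (∈-++⁺ˡ z∈ρ₁) , All.lookup r<ρ₁ z∈ρ₁ , z<y)))

  avoider⇒layered : {n : ℕ} {π : List ℕ} → Acc _<_ n → IsPerm n π →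
    Avoids π p132 → Avoids π p213 → ∃ λ t → All (1 ≤_) t × sum t ≡ n × π ≡ layered t
  avoider⇒layered {π = []} _ (|π|≡n , _) _ _ = [] , [] , |π|≡n , refl
  avoider⇒layered {π = suc r ∷ ρ} (acc smaller)
    (|π|≡n , (r∉ρ ∷ ρ-unique) , ((_ , r<n) ∷ ρ-bounds)) av132 av213
    with m≤n⇒∃[o]m+o≡n r<n
  ... | k , refl
    with avoider-split (suc r) ρ ρ-unique r∉ρ av132 av213
  ... | ρ₁ , ρ₂ , refl , r<ρ₁ , ρ₁-inc , ρ₂<r =
    layer (avoider⇒layered (smaller (s≤s (m≤m+n r k)))
                           (proj₂ lengths , Unique-++⁻ʳ ρ₁ ρ-unique , ρ₂-bounds)
                           (Avoids-resp-⊆ ρ₂⊆π av132) (Avoids-resp-⊆ ρ₂⊆π av213))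
    where
    ρ₁⊆block : ρ₁ ⊆ block (suc r) k
    ρ₁⊆block = Increasing⇒⊆block (suc r) k ρ₁-inc
      (All.zipWith (λ (r<y , (_ , y≤n)) → r<y , y≤n) (r<ρ₁ , ++⁻ˡ ρ₁ ρ-bounds))
    ρ₂-bounds : All (λ y → 1 ≤ y × y ≤ r) ρ₂
    ρ₂-bounds = All.zipWith (λ (y<r , (1≤y , _)) → 1≤y , ≤-pred y<r) (ρ₂<r , ++⁻ʳ ρ₁ ρ-bounds)
    -- ρ₁ lies in the block above r and ρ₂ injects into 1, …, r - 1, with n - 1 entries in all.
    lengths : length ρ₁ ≡ k × length ρ₂ ≡ r
    lengths = +-≤-≡⇒≡
      (≤-trans (length-mono-≤ ρ₁⊆block) (≤-reflexive (length-block (suc r) k)))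
      (≤-trans (Unique⇒length≤ (Unique-++⁻ʳ ρ₁ ρ-unique)
                                (All.map (λ (1≤y , y≤r) → ∈-block 1≤y y≤r) ρ₂-bounds))
               (≤-reflexive (length-block 0 r)))
      (trans (sym (length-++ ρ₁)) (trans (suc-injective |π|≡n) (+-comm r k)))
    ρ₁≡block : ρ₁ ≡ block (suc r) k
    ρ₁≡block = ≋⇒≡ (to-≋ (trans (proj₁ lengths) (sym (length-block (suc r) k))) ρ₁⊆block)
    ρ₂⊆π : ρ₂ ⊆ suc r ∷ ρ₁ ++ ρ₂
    ρ₂⊆π = suc r ∷ʳ ++⁺ˡ ρ₁ ⊆-refl
    layer : (∃ λ t → All (1 ≤_) t × sum t ≡ r × ρ₂ ≡ layered t) →
      ∃ λ t → All (1 ≤_) t × sum t ≡ suc r + k × suc r ∷ ρ₁ ++ ρ₂ ≡ layered t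
    layer (t , t⁺ , refl , ρ₂≡t) = suc k ∷ t , s≤s z≤n ∷ t⁺ , cong suc (+-comm k (sum t)) ,
                                   cong₂ (λ ρ₁′ ρ₂′ → suc (sum t) ∷ ρ₁′ ++ ρ₂′) ρ₁≡block ρ₂≡t

  -- Occurrences of β in layered permutations

  ≅-second : {x y u v : ℕ} {s σ : List ℕ} → x ∷ y ∷ s ≅ u ∷ v ∷ σ → SameOrder x u y v
  ≅-second ((so ∷ _) ∷ _) = so

  ≅-head-max : {x y u : ℕ} {s σ : List ℕ} → x ∷ y ∷ s ≅ u ∷ σ → All (_< u) σ → y < x
  ≅-head-max ((so ∷ _) ∷ _) (v<u ∷ _) = Equivalence.from (proj₂ so) v<u

  ≅-tail : {x u : ℕ} {s σ : List ℕ} → x ∷ s ≅ u ∷ σ → s ≅ σ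
  ≅-tail (_ ∷ s≅σ) = s≅σ

  -- Each entry of the decreasing part δ lies in a tile of its own.
  decreasing-occurrence : (t : List ℕ) {s δ σ : List ℕ} → s ⊆ layered t → s ≅ δ ++ σ →
    Decreasing δ → Above δ σ →
    ∃₂ λ p q → t ≡ p ++ q × length δ ≤ length p × ∃ λ s′ → s′ ⊆ layered q × s′ ≅ σ
  decreasing-occurrence t {s} {[]} s⊆ s≅σ _ _ = [] , t , refl , z≤n , s , s⊆ , s≅σ
  decreasing-occurrence [] {δ = _ ∷ _} [] ()
  decreasing-occurrence (l ∷ t) {δ = d ∷ δ} s⊆ s≅ δ-dec@(δ<d ∷ δ-dec′) δ>σ@(σ<d ∷ δ>σ′)
    with layered-⊆⁻ l t s⊆
  ... | [] , _ , refl , _ , _ , _ , s₂⊆ with decreasing-occurrence t s₂⊆ s≅ δ-dec δ>σ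
  ...   | p , q , refl , δ≤p , occ = l ∷ p , q , refl , m≤n⇒m≤1+n δ≤p , occ
  decreasing-occurrence (l ∷ t) {δ = d ∷ δ} s⊆ s≅ (δ<d ∷ δ-dec′) (σ<d ∷ δ>σ′)
    | _ ∷ [] , _ , refl , _ , _ , _ , s₂⊆ with decreasing-occurrence t s₂⊆ (≅-tail s≅) δ-dec′ δ>σ′
  ...   | p , q , refl , δ≤p , occ = l ∷ p , q , refl , s≤s δ≤p , occ
  decreasing-occurrence (l ∷ t) {δ = d ∷ δ} s⊆ s≅ (δ<d ∷ _) (σ<d ∷ _)
    | _ ∷ _ ∷ _ , _ , refl , _ , (y<y′ ∷ _) ∷ _ , _ , _ =
    ⊥-elim (<-asym y<y′ (≅-head-max s≅ (++⁺ δ<d σ<d)))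

  -- If an occurrence of ι ++ σ starts inside a block, the block contains exactly ι.
  block-occurrence : {x i : ℕ} (s₁ ι : List ℕ) {s₂ σ : List ℕ} → x ∷ s₁ ++ s₂ ≅ i ∷ ι ++ σ →
    Increasing (x ∷ s₁) → Above (x ∷ s₁) s₂ → Increasing (i ∷ ι) → Above (i ∷ ι) σ →
    length ι ≤ length s₁ × s₂ ≅ σ
  block-occurrence [] [] s≅ _ _ _ _ = z≤n , ≅-tail s≅
  block-occurrence [] (j ∷ ι) {[]} (() ∷ _) _ _ _ _
  block-occurrence [] (j ∷ ι) {y ∷ s₂} s≅ _ ((y<x ∷ _) ∷ []) ((i<j ∷ _) ∷ _) _ =
    ⊥-elim (<-asym y<x (Equivalence.from (proj₁ (≅-second s≅)) i<j))
  block-occurrence (y ∷ s₁) [] {σ = []} (() ∷ _) _ _ _ _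
  block-occurrence (y ∷ s₁) [] {σ = v ∷ σ} s≅ ((x<y ∷ _) ∷ _) _ _ ((v<i ∷ _) ∷ []) =
    ⊥-elim (<-asym x<y (Equivalence.from (proj₂ (≅-second s≅)) v<i))
  block-occurrence (y ∷ s₁) (j ∷ ι) s≅ (_ ∷ s₁-inc) (_ ∷ s₁>s₂) (_ ∷ ι-inc) (_ ∷ ι>σ) =
    let ι≤s₁ , s₂≅σ = block-occurrence s₁ ι (≅-tail s≅) s₁-inc s₁>s₂ ι-inc ι>σ
    in s≤s ι≤s₁ , s₂≅σ

  increasing-occurrence : (t : List ℕ) {s ι σ : List ℕ} {i : ℕ} → s ⊆ layered t →
    s ≅ i ∷ ι ++ σ → Increasing (i ∷ ι) → Above (i ∷ ι) σ →
    ∃₂ λ p x → ∃ λ q → t ≡ p ++ x ∷ q × suc (length ι) ≤ x × ∃ λ s′ → s′ ⊆ layered q × s′ ≅ σ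
  increasing-occurrence [] [] ()
  increasing-occurrence (l ∷ t) s⊆ s≅ ι-inc ι>σ with layered-⊆⁻ l t s⊆
  ... | [] , _ , refl , _ , _ , _ , s₂⊆ with increasing-occurrence t s₂⊆ s≅ ι-inc ι>σ
  ...   | p , x , q , refl , ι≤x , occ = l ∷ p , x , q , refl , ι≤x , occ
  increasing-occurrence (l ∷ t) {ι = ι} s⊆ s≅ ι-inc ι>σ
    | y ∷ s₁ , s₂ , refl , s₁≤l , s₁-inc , s₁>s₂ , s₂⊆ =
    let ι≤s₁ , s₂≅σ = block-occurrence s₁ ι s≅ s₁-inc s₁>s₂ ι-inc ι>σ
    in [] , l , t , refl , ≤-trans (s≤s ι≤s₁) s₁≤l , s₂ , s₂⊆ , s₂≅σ

  -- The first entries of the tiles of p decrease and lie above layered w.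
  prepend-decreasing : (p w : List ℕ) → All (1 ≤_) p → {δ σ s : List ℕ} →
    length δ ≤ length p → Decreasing δ → Above δ σ → s ⊆ layered w → s ≅ σ →
    ∃ λ s′ → s′ ⊆ layered (p ++ w) × s′ ≅ δ ++ σ
  prepend-decreasing p w _ {[]} {s = s} _ _ _ s⊆ s≅σ = s , ⊆-trans s⊆ (layered-suffix p w) , s≅σ
  prepend-decreasing (suc l ∷ p) w (_ ∷ p⁺) {d ∷ δ} (s≤s δ≤p) (δ<d ∷ δ-dec) (σ<d ∷ δ>σ) s⊆ s≅σ =
    let s′ , s′⊆ , s′≅ = prepend-decreasing p w p⁺ δ≤p δ-dec δ>σ s⊆ s≅σ
    in suc (sum (p ++ w)) ∷ s′ ,
       refl ∷ ++⁺ˡ (block (suc (sum (p ++ w))) l) s′⊆ ,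
       above-pointwise (All.map (λ (_ , y≤) → s≤s y≤) (All-resp-⊆ s′⊆ (layered-bounds (p ++ w))))
                       (++⁺ δ<d σ<d) (≅-length s′≅) ∷ s′≅

  applyUpTo-block : (s l : ℕ) {f : ℕ → ℕ} → (∀ i → f i ≡ suc (s + i)) → applyUpTo f l ≡ block s l
  applyUpTo-block s zero _ = refl
  applyUpTo-block s (suc l) f≗ =
    cong₂ _∷_ (trans (f≗ 0) (cong suc (+-identityʳ s)))
              (applyUpTo-block (suc s) l (λ i → trans (f≗ (suc i)) (cong suc (+-suc s i))))

  applyDownFrom-decreasing : (f : ℕ → ℕ) → (∀ {i j} → i < j → f i < f j) → (n : ℕ) →
    Decreasing (applyDownFrom f n)
  applyDownFrom-decreasing f f-mono n = AllPairs.applyDownFrom⁺₁ f n (λ j<i _ → f-mono j<i)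

  β-high : ℕ → ℕ → ℕ → List ℕ
  β-high a b c = applyDownFrom (λ i → b + c + 1 + i) a

  β-low : ℕ → List ℕ
  β-low c = applyDownFrom suc c

  β≡ : (a b c : ℕ) → β a b c ≡ β-high a b c ++ block c b ++ β-low c
  β≡ a b c = cong₂ _++_ (map-downFrom _ a) (cong₂ _++_ middle (map-downFrom suc c))
    where
    middle : map (λ i → c + 1 + i) (upTo b) ≡ block c b
    middle = trans (map-upTo _ b) (applyUpTo-block c b (λ i → cong (_+ i) (+-comm c 1)))

  β-low-bounds : (c : ℕ) → All (_≤ c) (β-low c)
  β-low-bounds c = applyDownFrom⁺₁ suc c (λ i<c → i<c)

  β-high-above : (a b c : ℕ) → Above (β-high a b c) (block c b ++ β-low c)
  β-high-above a b c = applyDownFrom⁺₁ _ a (λ {i} _ → All.map (below i) (++⁺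
    (All.map (λ (_ , y≤c+b) → ≤-trans y≤c+b (≤-reflexive (+-comm c b))) (block-bounds c b))
    (All.map (λ y≤c → ≤-trans y≤c (m≤n+m c b)) (β-low-bounds c))))
    where
    below : ∀ {y} i → y ≤ b + c → y < b + c + 1 + i
    below i y≤ = ≤-trans (≤-trans (s≤s y≤) (≤-reflexive (+-comm 1 (b + c)))) (m≤m+n (b + c + 1) i)

  block-above-β-low : (b c : ℕ) → Above (block c b) (β-low c)
  block-above-β-low b c = All.map (λ (c<x , _) → All.map (λ y≤c → ≤-<-trans y≤c c<x) (β-low-bounds c))
                                  (block-bounds c b)

  HasWideTile : ℕ → ℕ → ℕ → List ℕ → Set
  HasWideTile a b c t = ∃₂ λ p x → ∃ λ q → t ≡ p ++ x ∷ q × a ≤ length p × c ≤ length q × b ≤ x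

  layered-contains-β⇒ : (a b c : ℕ) → 1 ≤ b → (t : List ℕ) →
    Contains (layered t) (β a b c) → HasWideTile a b c t
  layered-contains-β⇒ a (suc b) c _ t contains
    with Equivalence.to Contains⇔Contains≅ (subst (Contains (layered t)) (β≡ a (suc b) c) contains)
  ... | s , s⊆ , s≅
    with decreasing-occurrence t s⊆ s≅ (applyDownFrom-decreasing _ (λ i<j → +-monoʳ-< _ i<j) a)
                               (β-high-above a (suc b) c)
  ... | p , r , refl , a≤p , s′ , s′⊆ , s′≅
    with increasing-occurrence r s′⊆ s′≅ (block-increasing c (suc b)) (block-above-β-low (suc b) c)
  ... | p′ , x , q , refl , b≤x , s″ , s″⊆ , s″≅
    with decreasing-occurrence q s″⊆ (subst (s″ ≅_) (sym (++-identityʳ (β-low c))) s″≅)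
                               (applyDownFrom-decreasing suc s≤s c) (All.universal (λ _ → []) _)
  ... | p″ , q′ , refl , c≤p″ , _ =
    p ++ p′ , x , p″ ++ q′ , sym (++-assoc p p′ _) ,
    ≤-trans (≤-trans (≤-reflexive (sym (length-applyDownFrom _ a))) a≤p)
            (length-mono-≤ (++⁺ʳ p′ (⊆-refl {x = p}))) ,
    ≤-trans (≤-trans (≤-reflexive (sym (length-applyDownFrom suc c))) c≤p″)
            (length-mono-≤ (++⁺ʳ q′ (⊆-refl {x = p″}))) ,
    ≤-trans (s≤s (≤-reflexive (sym (length-block (suc c) b)))) b≤x

  β-low-occurrence : (c : ℕ) (q : List ℕ) → All (1 ≤_) q → c ≤ length q →
    ∃ λ s → s ⊆ layered q × s ≅ β-low c
  β-low-occurrence c q q⁺ c≤q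
    with prepend-decreasing q [] q⁺ (≤-trans (≤-reflexive (length-applyDownFrom suc c)) c≤q)
           (applyDownFrom-decreasing suc s≤s c) (All.universal (λ _ → []) _) [] []
  ... | s , s⊆ , s≅ = s , subst (λ q′ → s ⊆ layered q′) (++-identityʳ q) s⊆ ,
                          subst (s ≅_) (++-identityʳ (β-low c)) s≅

  wideTile⇒layered-contains-β : (a b c : ℕ) (t : List ℕ) → All (1 ≤_) t →
    HasWideTile a b c t → Contains (layered t) (β a b c)
  wideTile⇒layered-contains-β a b c _ t⁺ (p , x , q , refl , a≤p , c≤q , b≤x)
    with β-low-occurrence c q (++⁻ʳ (x ∷ []) (++⁻ʳ p t⁺)) c≤q
  ... | s , s⊆ , s≅
    with prepend-decreasing p (x ∷ q) (++⁻ˡ p t⁺) {δ = β-high a b c}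
           (≤-trans (≤-reflexive (length-applyDownFrom _ a)) a≤p)
           (applyDownFrom-decreasing _ (λ i<j → +-monoʳ-< _ i<j) a) (β-high-above a b c)
           (⊆-++⁺ (block-⊆ (sum q) b≤x) s⊆)
           (≅-++⁺ (Increasing-≅ (block-increasing (sum q) b) (block-increasing c b)
                                (trans (length-block (sum q) b) (sym (length-block c b))))
                  s≅ block>s (block-above-β-low b c))
    where
    block>s : Above (block (sum q) b) s
    block>s = All.map (λ (q<y , _) → All.map (λ (_ , z≤q) → ≤-<-trans z≤q q<y)
                                              (All-resp-⊆ s⊆ (layered-bounds q)))
                      (block-bounds (sum q) b)
  ... | s′ , s′⊆ , s′≅ =
    subst (Contains (layered (p ++ x ∷ q))) (sym (β≡ a b c))
          (Equivalence.from Contains⇔Contains≅ (s′ , s′⊆ , s′≅))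

  -- Restricted tilings

  split-at-index : (t : List ℕ) (i : Fin (length t)) →
    ∃₂ λ p q → t ≡ p ++ lookup t i ∷ q × length p ≡ toℕ i
  split-at-index (x ∷ t) zero = [] , t , refl , refl
  split-at-index (x ∷ t) (suc i) =
    let p , q , t≡ , |p|≡i = split-at-index t i in x ∷ p , q , cong (x ∷_) t≡ , cong suc |p|≡i

  index-of-split : (p : List ℕ) {x : ℕ} {q : List ℕ} →
    ∃ λ (i : Fin (length (p ++ x ∷ q))) → toℕ i ≡ length p × lookup (p ++ x ∷ q) i ≡ x
  index-of-split [] = zero , refl , refl
  index-of-split (y ∷ p) = let i , i≡p , lookup≡x = index-of-split p in suc i , cong suc i≡p , lookup≡x

  Narrow : ℕ → ℕ → ℕ → List ℕ → Set
  Narrow a b c t = ∀ p x q → t ≡ p ++ x ∷ q → a ≤ length p → c ≤ length q → x ≤ b ∸ 1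

  Restricted⇒Narrow : (a b c : ℕ) (t : List ℕ) → Restricted a b c t → Narrow a b c t
  Restricted⇒Narrow a b c _ restricted p x q refl a≤p c≤q with index-of-split p {x} {q}
  ... | i , i≡p , lookup≡x = subst (_≤ b ∸ 1) lookup≡x
    (restricted i (subst (a ≤_) (sym i≡p) a≤p) (begin-strict
      toℕ i + c                 ≡⟨ cong (_+ c) i≡p ⟩
      length p + c              <⟨ +-monoʳ-< (length p) (s≤s c≤q) ⟩
      length p + length (x ∷ q) ≡⟨ sym (length-++ p) ⟩
      length (p ++ x ∷ q)       ∎))
    where open ≤-Reasoning

  Narrow⇒Restricted : (a b c : ℕ) (t : List ℕ) → Narrow a b c t → Restricted a b c t
  Narrow⇒Restricted a b c t narrow i a≤i i+c<t with split-at-index t i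
  ... | p , q , t≡ , |p|≡i =
    narrow p (lookup t i) q t≡ (subst (a ≤_) (sym |p|≡i) a≤i)
           (≤-pred (+-cancelˡ-< (length p) c (suc (length q)) p+c<))
    where
    p+c< : length p + c < length p + suc (length q)
    p+c< = begin-strict
      length p + c                 ≡⟨ cong (_+ c) |p|≡i ⟩
      toℕ i + c                    <⟨ i+c<t ⟩
      length t                     ≡⟨ cong length t≡ ⟩
      length (p ++ lookup t i ∷ q) ≡⟨ length-++ p ⟩
      length p + suc (length q)    ∎
      where open ≤-Reasoning

  Narrow⇒¬HasWideTile : (a b c : ℕ) → 1 ≤ b → (t : List ℕ) → Narrow a b c t → ¬ HasWideTile a b c t
  Narrow⇒¬HasWideTile a (suc b) c _ _ narrow (p , x , q , t≡ , a≤p , c≤q , b<x) =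
    <⇒≱ b<x (narrow p x q t≡ a≤p c≤q)

  ¬HasWideTile⇒Narrow : (a b c : ℕ) (t : List ℕ) → ¬ HasWideTile a b c t → Narrow a b c t
  ¬HasWideTile⇒Narrow a b c t no-wide p x q t≡ a≤p c≤q with x ≤? b ∸ 1
  ... | yes x≤b-1 = x≤b-1
  ... | no x≰b-1 = ⊥-elim (no-wide (p , x , q , t≡ , a≤p , c≤q , ∸1<⇒≤ b (≰⇒> x≰b-1)))
    where
    ∸1<⇒≤ : ∀ b {x} → b ∸ 1 < x → b ≤ x
    ∸1<⇒≤ zero _ = z≤n
    ∸1<⇒≤ (suc _) b-1<x = b-1<x

  patterns : ℕ → ℕ → ℕ → List (List ℕ)
  patterns a b c = p132 ∷ p213 ∷ β a b c ∷ []

  RestrictedTiling : ℕ → ℕ → ℕ → ℕ → List ℕ → Set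
  RestrictedTiling a b c n t = Tiling n t × Restricted a b c t

  layered∈S : (a b c : ℕ) → 1 ≤ b → {n : ℕ} {t : List ℕ} →
    RestrictedTiling a b c n t → S n (patterns a b c) (layered t)
  layered∈S a b c b≥1 {t = t} ((_ , refl) , restricted) =
    layered-isPerm t ,
    layered-avoids-132 t ∷ layered-avoids-213 t ∷
    (λ contains → Narrow⇒¬HasWideTile a b c b≥1 t (Restricted⇒Narrow a b c t restricted)
                                      (layered-contains-β⇒ a b c b≥1 t contains)) ∷ []

  S⇒layered : (a b c : ℕ) {n : ℕ} {π : List ℕ} → S n (patterns a b c) π →
    ∃ λ t → RestrictedTiling a b c n t × π ≡ layered t
  S⇒layered a b c (isPerm , av132 ∷ av213 ∷ avβ ∷ [])
    with avoider⇒layered (<-wellFounded _) isPerm av132 av213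
  ... | t , t⁺ , Σt≡n , π≡ =
    t , ((t⁺ , Σt≡n) , Narrow⇒Restricted a b c t (¬HasWideTile⇒Narrow a b c t
                         (λ wide → avβ (subst (λ π → Contains π (β a b c)) (sym π≡)
                                            (wideTile⇒layered-contains-β a b c t t⁺ wide))))) , π≡

  𝓕∈RestrictedTiling : (a b c : ℕ) {n : ℕ} {π : List ℕ} → S n (patterns a b c) π →
    RestrictedTiling a b c n (𝓕 π)
  𝓕∈RestrictedTiling a b c π∈S with S⇒layered a b c π∈S
  ... | t , tiling@((t⁺ , _) , _) , refl = subst (RestrictedTiling a b c _) (sym (𝓕-layered t t⁺)) tiling

  𝓕-injective : (a b c : ℕ) {n : ℕ} {π π′ : List ℕ} → S n (patterns a b c) π →
    S n (patterns a b c) π′ → 𝓕 π ≡ 𝓕 π′ → π ≡ π′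
  𝓕-injective a b c π∈S π′∈S 𝓕π≡𝓕π′ with S⇒layered a b c π∈S | S⇒layered a b c π′∈S
  ... | t , ((t⁺ , _) , _) , refl | t′ , ((t′⁺ , _) , _) , refl =
    cong layered (trans (sym (𝓕-layered t t⁺)) (trans 𝓕π≡𝓕π′ (𝓕-layered t′ t′⁺)))

  𝓕-surjective : (a b c : ℕ) → 1 ≤ b → {n : ℕ} {t : List ℕ} → RestrictedTiling a b c n t →
    ∃ λ π → S n (patterns a b c) π × 𝓕 π ≡ t
  𝓕-surjective a b c 1≤b {t = t} tiling@((t⁺ , _) , _) = layered t , layered∈S a b c 1≤b tiling , 𝓕-layered t t⁺

  Enumerates : {A : Set} → List A → (A → Set) → Set
  Enumerates L P = Unique L × (∀ x → x ∈ L ⇔ P x)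

  Enumerates-length : {A : Set} {L L′ : List A} {P : A → Set} →
    Enumerates L P → Enumerates L′ P → length L ≡ length L′
  Enumerates-length (u , L⇔P) (u′ , L′⇔P) = ≤-antisym
    (Unique⇒length≤ u (All.tabulate λ {x} x∈L → Equivalence.from (L′⇔P x) (Equivalence.to (L⇔P x) x∈L)))
    (Unique⇒length≤ u′ (All.tabulate λ {x} x∈L′ → Equivalence.from (L⇔P x) (Equivalence.to (L′⇔P x) x∈L′)))

  Enumerates⇒HasCard : {L : List (List ℕ)} {P : List ℕ → Set} → Enumerates L P → HasCard P (length L)
  Enumerates⇒HasCard {L} (u , L⇔P) = L , u , L⇔P , refl

  Enumerates-resp-⇔ : {A : Set} {L : List A} {P Q : A → Set} →
    (∀ x → P x ⇔ Q x) → Enumerates L P → Enumerates L Q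
  Enumerates-resp-⇔ P⇔Q (u , L⇔P) = u , λ x → ⇔-trans (L⇔P x) (P⇔Q x)

  Enumerates-++ : {A : Set} {L L′ : List A} {P Q : A → Set} → Enumerates L P → Enumerates L′ Q →
    (∀ {x} → P x → Q x → ⊥) → Enumerates (L ++ L′) (λ x → P x ⊎ Q x)
  Enumerates-++ {L = L} (u , L⇔P) (u′ , L′⇔Q) disjoint =
    Unique.++⁺ u u′ (λ {x} (x∈L , x∈L′) →
                       disjoint (Equivalence.to (L⇔P x) x∈L) (Equivalence.to (L′⇔Q x) x∈L′)) ,
    λ x → mk⇔ (Sum.map (Equivalence.to (L⇔P x)) (Equivalence.to (L′⇔Q x)) ∘ ∈-++⁻ L)
              (Sum.[ ∈-++⁺ˡ ∘ Equivalence.from (L⇔P x) , ∈-++⁺ʳ L ∘ Equivalence.from (L′⇔Q x) ])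

  Enumerates-map : {A B : Set} (f : A → B) {L : List A} {P : A → Set} →
    (∀ {x y} → P x → P y → f x ≡ f y → x ≡ y) → Enumerates L P →
    Enumerates (map f L) (λ y → ∃ λ x → P x × y ≡ f x)
  Enumerates-map f {L} {P} injective (u , L⇔P) =
    AllPairs.map⁺ (distinct (All.tabulate λ {x} → Equivalence.to (L⇔P x)) u) ,
    λ y → mk⇔ (λ y∈ → let x , x∈L , y≡fx = ∈-map⁻ f y∈ in x , Equivalence.to (L⇔P x) x∈L , y≡fx)
              (λ (x , Px , y≡fx) → subst (_∈ map f L) (sym y≡fx) (∈-map⁺ f (Equivalence.from (L⇔P x) Px)))
    where
    distinct : ∀ {xs} → All P xs → Unique xs → AllPairs (λ x y → f x ≢ f y) xs
    distinct [] [] = []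
    distinct (Px ∷ Pxs) (x∉xs ∷ xs-unique) =
      All.zipWith (λ (Py , x≢y) fx≡fy → x≢y (injective Px Py fx≡fy)) (Pxs , x∉xs) ∷ distinct Pxs xs-unique

  -- The parts f i are told apart by the key of their elements.
  Enumerates-concatMap : {I A : Set} (f : I → List A) {P : I → A → Set} (key : A → I) {is : List I} →
    Unique is → (∀ i → Enumerates (f i) (P i)) → (∀ {i x} → i ∈ is → P i x → key x ≡ i) →
    Enumerates (concatMap f is) (λ x → ∃ λ i → i ∈ is × P i x)
  Enumerates-concatMap f {P} key {is} is-unique enum key≡ = unique is (λ j∈ → j∈) is-unique , membership
    where
    ∈f⇔P : ∀ i x → x ∈ f i ⇔ P i x
    ∈f⇔P i = proj₂ (enum i)
    membership : ∀ x → x ∈ concatMap f is ⇔ (∃ λ i → i ∈ is × P i x)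
    membership x = mk⇔
      (λ x∈ → let i , i∈is , x∈fi = find (∈-concatMap⁻ f x∈) in i , i∈is , Equivalence.to (∈f⇔P i x) x∈fi)
      (λ (i , i∈is , Pix) → ∈-concatMap⁺ f (lose i∈is (Equivalence.from (∈f⇔P i x) Pix)))
    key-of : ∀ {i x} → i ∈ is → x ∈ f i → key x ≡ i
    key-of {i} {x} i∈is x∈fi = key≡ i∈is (Equivalence.to (∈f⇔P i x) x∈fi)
    unique : (js : List _) → (∀ {j} → j ∈ js → j ∈ is) → Unique js → Unique (concatMap f js)
    unique [] _ _ = []
    unique (j ∷ js) js⊆is (j∉js ∷ js-unique) =
      Unique.++⁺ (proj₁ (enum j)) (unique js (js⊆is ∘ there) js-unique)
        (λ (x∈fj , x∈rest) →
          let i , i∈js , x∈fi = find (∈-concatMap⁻ f x∈rest)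
          in All.lookup j∉js i∈js (trans (sym (key-of (js⊆is (here refl)) x∈fj)) (key-of (js⊆is (there i∈js)) x∈fi)))

  HasCard-unique : {P : List ℕ → Set} {N M : ℕ} → HasCard P N → HasCard P M → N ≡ M
  HasCard-unique (L , u , L⇔P , refl) (L′ , u′ , L′⇔P , refl) = Enumerates-length (u , L⇔P) (u′ , L′⇔P)

  -- Counting restricted tilings

  growHead : List ℕ → List ℕ
  growHead [] = []
  growHead (x ∷ xs) = suc x ∷ xs

  compositions : ℕ → ℕ → List (List ℕ)
  compositions zero zero = [] ∷ []
  compositions zero (suc k) = []
  compositions (suc n) zero = []
  compositions (suc n) (suc k) = map (1 ∷_) (compositions n k) ++ map growHead (compositions n (suc k))

  ∈-compositions⁻ : (n k : ℕ) {t : List ℕ} → t ∈ compositions n k → Tiling n t × length t ≡ k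
  ∈-compositions⁻ zero zero (here refl) = ([] , refl) , refl
  ∈-compositions⁻ (suc n) (suc k) t∈ with ∈-++⁻ (map (1 ∷_) (compositions n k)) t∈
  ... | inj₁ t∈₁ with ∈-map⁻ (1 ∷_) t∈₁
  ...   | t′ , t′∈ , refl with ∈-compositions⁻ n k t′∈
  ...     | (t′⁺ , refl) , refl = (s≤s z≤n ∷ t′⁺ , refl) , refl
  ∈-compositions⁻ (suc n) (suc k) t∈ | inj₂ t∈₂ with ∈-map⁻ growHead t∈₂
  ...   | t′ , t′∈ , refl with ∈-compositions⁻ n (suc k) t′∈
  ...     | ((_ ∷ t′⁺) , refl) , refl = (s≤s z≤n ∷ t′⁺ , refl) , refl

  ∈-compositions⁺ : (n : ℕ) {t : List ℕ} → Tiling n t → t ∈ compositions n (length t)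
  ∈-compositions⁺ zero {[]} _ = here refl
  ∈-compositions⁺ zero {x ∷ t} (1≤x ∷ _ , Σ≡0) = ⊥-elim (<⇒≱ (≤-trans 1≤x (m≤m+n x _)) (≤-reflexive Σ≡0))
  ∈-compositions⁺ (suc n) {suc zero ∷ t} (_ ∷ t⁺ , Σ≡) =
    ∈-++⁺ˡ (∈-map⁺ (1 ∷_) (∈-compositions⁺ n (t⁺ , suc-injective Σ≡)))
  ∈-compositions⁺ (suc n) {suc (suc x) ∷ t} (_ ∷ t⁺ , Σ≡) =
    ∈-++⁺ʳ _ (∈-map⁺ growHead (∈-compositions⁺ n (s≤s z≤n ∷ t⁺ , suc-injective Σ≡)))

  compositions-unique : (n k : ℕ) → Unique (compositions n k)
  compositions-unique zero zero = [] ∷ []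
  compositions-unique zero (suc k) = []
  compositions-unique (suc n) zero = []
  compositions-unique (suc n) (suc k) = Unique.++⁺
    (Unique.map⁺ ∷-injectiveʳ (compositions-unique n k))
    (Unique.map⁺ growHead-injective (compositions-unique n (suc k)))
    (λ (t∈₁ , t∈₂) → head-differs (∈-map⁻ (1 ∷_) t∈₁) (∈-map⁻ growHead t∈₂))
    where
    growHead-injective : ∀ {xs ys} → growHead xs ≡ growHead ys → xs ≡ ys
    growHead-injective {[]} {[]} _ = refl
    growHead-injective {_ ∷ _} {_ ∷ _} e = cong₂ _∷_ (suc-injective (∷-injectiveˡ e)) (∷-injectiveʳ e)
    head-differs : ∀ {t} → (∃ λ t′ → t′ ∈ compositions n k × t ≡ 1 ∷ t′) →
      (∃ λ t′ → t′ ∈ compositions n (suc k) × t ≡ growHead t′) → ⊥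
    head-differs (_ , _ , refl) (t′ , t′∈ , e) with t′ | ∈-compositions⁻ n (suc k) t′∈
    ... | _ ∷ _ | (1≤x ∷ _ , _) , _ = <⇒≢ 1≤x (suc-injective (∷-injectiveˡ e))

  length-compositions : (n k : ℕ) → 1 ≤ n → 1 ≤ k → length (compositions n k) ≡ (n ∸ 1) C (k ∸ 1)
  length-compositions-pascal : (n k : ℕ) →
    length (compositions n k) + length (compositions n (suc k)) ≡ n C k

  length-compositions (suc n) (suc k) _ _ = begin
    length (map (1 ∷_) (compositions n k) ++ map growHead (compositions n (suc k)))
      ≡⟨ length-++ (map (1 ∷_) (compositions n k)) ⟩
    length (map (1 ∷_) (compositions n k)) + length (map growHead (compositions n (suc k)))
      ≡⟨ cong₂ _+_ (length-map (1 ∷_) (compositions n k)) (length-map growHead (compositions n (suc k))) ⟩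
    length (compositions n k) + length (compositions n (suc k))
      ≡⟨ length-compositions-pascal n k ⟩
    n C k ∎
    where open ≡-Reasoning

  length-compositions-pascal zero zero = refl
  length-compositions-pascal zero (suc k) = refl
  length-compositions-pascal (suc n) zero =
    trans (length-compositions (suc n) 1 (s≤s z≤n) (s≤s z≤n)) (trans (nC0≡1 n) (sym (nC0≡1 (suc n))))
  length-compositions-pascal (suc n) (suc k) =
    trans (cong₂ _+_ (length-compositions (suc n) (suc k) (s≤s z≤n) (s≤s z≤n))
                     (length-compositions (suc n) (suc (suc k)) (s≤s z≤n) (s≤s z≤n)))
          (nCk+nC[k+1]≡[n+1]C[k+1] n k)

  compositions-enumerates : (n k : ℕ) → Enumerates (compositions n k) (λ t → Tiling n t × length t ≡ k)
  compositions-enumerates n k = compositions-unique n k ,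
    λ t → mk⇔ (∈-compositions⁻ n k) (λ (tiling , |t|≡k) → subst (λ k → t ∈ compositions n k) |t|≡k
                                                                 (∈-compositions⁺ n tiling))

  BoundedTiling : ℕ → ℕ → List ℕ → Set
  BoundedTiling B m t = All (λ x → 1 ≤ x × x ≤ B) t × sum t ≡ m

  -- The entries of a table enumerate P (m - 1), …, P 1, P 0 in this order.
  EnumeratesTable : (ℕ → List ℕ → Set) → ℕ → List (List (List ℕ)) → Set
  EnumeratesTable P zero [] = ⊤
  EnumeratesTable P (suc m) (X ∷ Xs) = Enumerates X (P m) × EnumeratesTable P m Xs
  EnumeratesTable P zero (_ ∷ _) = ⊥
  EnumeratesTable P (suc m) [] = ⊥

  -- prependTiles h k Xs puts the tile h + j in front of the entry j of Xs, for j < k.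
  prependTiles : ℕ → ℕ → List (List (List ℕ)) → List (List ℕ)
  prependTiles h zero _ = []
  prependTiles h (suc k) [] = []
  prependTiles h (suc k) (X ∷ Xs) = map (h ∷_) X ++ prependTiles (suc h) k Xs

  module _ (P : ℕ → List ℕ → Set) where

    ∈-prependTiles⁻ : (h k m N : ℕ) {Xs : List (List (List ℕ))} → EnumeratesTable P m Xs →
      h + m ≡ suc N → {t : List ℕ} → t ∈ prependTiles h k Xs →
      ∃₂ λ x t′ → t ≡ x ∷ t′ × h ≤ x × x < h + k × x ≤ N × P (N ∸ x) t′
    ∈-prependTiles⁻ h (suc k) (suc m) N {X ∷ Xs} ((_ , X⇔) , table) h+m≡ t∈
      with ∈-++⁻ (map (h ∷_) X) t∈
    ... | inj₁ t∈X with ∈-map⁻ (h ∷_) t∈X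
    ...   | t′ , t′∈X , refl =
      h , t′ , refl , ≤-refl , ≤-trans (s≤s (m≤m+n h k)) (≤-reflexive (sym (+-suc h k))) ,
      ≤-trans (m≤m+n h m) (≤-reflexive m≡N) ,
      subst (λ j → P j t′) (sym (trans (cong (_∸ h) (sym m≡N)) (m+n∸m≡n h m))) (Equivalence.to (X⇔ t′) t′∈X)
      where
      m≡N : h + m ≡ N
      m≡N = suc-injective (trans (sym (+-suc h m)) h+m≡)
    ∈-prependTiles⁻ h (suc k) (suc m) N {X ∷ Xs} (_ , table) h+m≡ t∈ | inj₂ t∈rest
      with ∈-prependTiles⁻ (suc h) k m N table (trans (sym (+-suc h m)) h+m≡) t∈rest
    ... | x , t′ , refl , h<x , x<h+k , x≤N , Pt′ =
      x , t′ , refl , <⇒≤ h<x , ≤-trans x<h+k (≤-reflexive (sym (+-suc h k))) , x≤N , Pt′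

    ∈-prependTiles⁺ : (h k m N : ℕ) {Xs : List (List (List ℕ))} → EnumeratesTable P m Xs →
      h + m ≡ suc N → {x : ℕ} {t′ : List ℕ} → h ≤ x → x < h + k → x ≤ N → P (N ∸ x) t′ →
      x ∷ t′ ∈ prependTiles h k Xs
    ∈-prependTiles⁺ h zero m N _ _ h≤x x<h+0 _ _ =
      ⊥-elim (<⇒≱ x<h+0 (≤-trans (≤-reflexive (+-identityʳ h)) h≤x))
    ∈-prependTiles⁺ h (suc k) zero N {[]} _ h+0≡ h≤x _ x≤N _ =
      ⊥-elim (<⇒≱ (s≤s x≤N) (≤-trans (≤-reflexive (trans (sym h+0≡) (+-identityʳ h))) h≤x))
    ∈-prependTiles⁺ h (suc k) (suc m) N {X ∷ Xs} ((_ , X⇔) , table) h+m≡ {x} {t′} h≤x x<h+k x≤N Pt′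
      with m≤n⇒m<n∨m≡n h≤x
    ... | inj₂ refl = ∈-++⁺ˡ (∈-map⁺ (x ∷_) (Equivalence.from (X⇔ t′)
            (subst (λ j → P j t′) (trans (cong (_∸ x) (sym m≡N)) (m+n∸m≡n x m)) Pt′)))
      where
      m≡N : x + m ≡ N
      m≡N = suc-injective (trans (sym (+-suc x m)) h+m≡)
    ... | inj₁ h<x = ∈-++⁺ʳ (map (h ∷_) X) (∈-prependTiles⁺ (suc h) k m N table
            (trans (sym (+-suc h m)) h+m≡) h<x (≤-trans x<h+k (≤-reflexive (+-suc h k))) x≤N Pt′)

    prependTiles-unique : (h k m : ℕ) {Xs : List (List (List ℕ))} → EnumeratesTable P m Xs →
      Unique (prependTiles h k Xs)
    prependTiles-unique h zero m _ = []
    prependTiles-unique h (suc k) m {[]} _ = []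
    prependTiles-unique h (suc k) (suc m) {X ∷ Xs} ((X-unique , _) , table) = Unique.++⁺
      (Unique.map⁺ ∷-injectiveʳ X-unique)
      (prependTiles-unique (suc h) k m table)
      (λ (t∈X , t∈rest) → let _ , _ , t≡ = ∈-map⁻ (h ∷_) t∈X
                              _ , _ , t≡′ , h<x = heads (suc h) k Xs t∈rest
                          in <-irrefl (∷-injectiveˡ (trans (sym t≡) t≡′)) h<x)
      where
      heads : (h k : ℕ) (Xs : List (List (List ℕ))) {t : List ℕ} → t ∈ prependTiles h k Xs →
        ∃₂ λ x t′ → t ≡ x ∷ t′ × h ≤ x
      heads h (suc k) (X ∷ Xs) t∈ with ∈-++⁻ (map (h ∷_) X) t∈
      ... | inj₁ t∈X = let t′ , _ , t≡ = ∈-map⁻ (h ∷_) t∈X in h , t′ , t≡ , ≤-refl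
      ... | inj₂ t∈rest = let x , t′ , t≡ , h<x = heads (suc h) k Xs t∈rest in x , t′ , t≡ , <⇒≤ h<x

  length-prependTiles : (h k : ℕ) (Xs : List (List (List ℕ))) →
    length (prependTiles h k Xs) ≡ sum (take k (map length Xs))
  length-prependTiles h zero Xs = refl
  length-prependTiles h (suc k) [] = refl
  length-prependTiles h (suc k) (X ∷ Xs) =
    trans (length-++ (map (h ∷_) X))
          (cong₂ _+_ (length-map (h ∷_) X) (length-prependTiles (suc h) k Xs))

  boundedTilings : ℕ → ℕ → List (List ℕ)
  boundedTable : ℕ → ℕ → List (List (List ℕ))

  boundedTilings B zero = [] ∷ []
  boundedTilings B (suc m) = prependTiles 1 B (boundedTable B (suc m))

  -- boundedTable B m = boundedTilings B (m - 1) ∷ … ∷ boundedTilings B 0 ∷ []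
  boundedTable B zero = []
  boundedTable B (suc m) = boundedTilings B m ∷ boundedTable B m

  boundedTilings-suc-enumerates : (B m : ℕ) →
    EnumeratesTable (BoundedTiling B) (suc m) (boundedTable B (suc m)) →
    Enumerates (boundedTilings B (suc m)) (BoundedTiling B (suc m))
  boundedTilings-suc-enumerates B m table =
    prependTiles-unique (BoundedTiling B) 1 B (suc m) table , λ t → mk⇔ sound complete
    where
    sound : ∀ {t} → t ∈ boundedTilings B (suc m) → BoundedTiling B (suc m) t
    sound t∈ with ∈-prependTiles⁻ (BoundedTiling B) 1 B (suc m) (suc m) table refl t∈
    ... | x , t′ , refl , 1≤x , x<1+B , x≤ , (t′-bounds , Σt′≡) =
      (1≤x , ≤-pred x<1+B) ∷ t′-bounds , trans (cong (x +_) Σt′≡) (m+[n∸m]≡n x≤)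
    complete : ∀ {t} → BoundedTiling B (suc m) t → t ∈ boundedTilings B (suc m)
    complete ([] , ())
    complete {x ∷ t′} (((1≤x , x≤B) ∷ t′-bounds) , Σ≡) =
      ∈-prependTiles⁺ (BoundedTiling B) 1 B (suc m) (suc m) table refl 1≤x (s≤s x≤B)
        (≤-trans (m≤m+n x _) (≤-reflexive Σ≡))
        (t′-bounds , sym (trans (cong (_∸ x) (sym Σ≡)) (m+n∸m≡n x _)))

  boundedTilings-enumerates : (B m : ℕ) → Enumerates (boundedTilings B m) (BoundedTiling B m)
  boundedTable-enumerates : (B m : ℕ) → EnumeratesTable (BoundedTiling B) m (boundedTable B m)

  boundedTable-enumerates B zero = tt
  boundedTable-enumerates B (suc m) = boundedTilings-enumerates B m , boundedTable-enumerates B m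

  boundedTilings-enumerates B zero = [] ∷ [] , λ t → mk⇔ (λ { (here refl) → [] , refl }) empty
    where
    empty : ∀ {t} → BoundedTiling B zero t → t ∈ [] ∷ []
    empty ([] , _) = here refl
    empty (((1≤x , _) ∷ _) , Σ≡0) = ⊥-elim (<⇒≱ (≤-trans 1≤x (m≤m+n _ _)) (≤-reflexive Σ≡0))
  boundedTilings-enumerates B (suc m) =
    boundedTilings-suc-enumerates B m (boundedTable-enumerates B (suc m))

  length-boundedTable : (B m : ℕ) → map length (boundedTable B m) ≡ fibs B m
  length-boundedTilings : (B m : ℕ) → length (boundedTilings B m) ≡ fib B (suc m)

  length-boundedTable B zero = refl
  length-boundedTable B (suc m) = cong₂ _∷_ (length-boundedTilings B m) (length-boundedTable B m)

  length-boundedTilings B zero = refl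
  length-boundedTilings B (suc m) =
    trans (length-prependTiles 1 B (boundedTable B (suc m)))
          (cong (sum ∘ take B) (length-boundedTable B (suc m)))

  splice : ℕ → List ℕ → List ℕ → List ℕ
  splice a u v = take a u ++ v ++ drop a u

  unsplice : ℕ → ℕ → List ℕ → List ℕ
  unsplice a c t = take a t ++ drop (length t ∸ c) t

  splice-++ : {a : ℕ} (p q v : List ℕ) → length p ≡ a → splice a (p ++ q) v ≡ p ++ v ++ q
  splice-++ p q v refl = cong₂ (λ p′ q′ → p′ ++ v ++ q′) (take-length-++ p) (drop-length-++ p)

  splice-injective : (a : ℕ) (u : List ℕ) {v v′ : List ℕ} → splice a u v ≡ splice a u v′ → v ≡ v′
  splice-injective a u {v} {v′} e =
    ++-cancelʳ (drop a u) v v′ (++-cancelˡ (take a u) (v ++ drop a u) (v′ ++ drop a u) e)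

  unsplice-splice : (a c : ℕ) (u v : List ℕ) → length u ≡ a + c → unsplice a c (splice a u v) ≡ u
  unsplice-splice a c u v |u|≡ with splitAt-length a u (≤-trans (m≤m+n a c) (≤-reflexive (sym |u|≡)))
  ... | p , q , refl , refl rewrite splice-++ p q v refl = cong₂ _++_ (take-length-++ p) dropped
    where
    |q|≡c : length q ≡ c
    |q|≡c = +-cancelˡ-≡ (length p) _ _ (trans (sym (length-++ p)) |u|≡)
    dropped : drop (length (p ++ v ++ q) ∸ c) (p ++ v ++ q) ≡ q
    dropped = begin
      drop (length (p ++ v ++ q) ∸ c) (p ++ v ++ q)
        ≡⟨ cong (λ w → drop (length w ∸ c) w) (sym (++-assoc p v q)) ⟩
      drop (length ((p ++ v) ++ q) ∸ c) ((p ++ v) ++ q)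
        ≡⟨ cong (λ n → drop (n ∸ c) ((p ++ v) ++ q))
                (trans (length-++ (p ++ v)) (cong (length (p ++ v) +_) |q|≡c)) ⟩
      drop (length (p ++ v) + c ∸ c) ((p ++ v) ++ q)
        ≡⟨ cong (λ n → drop n ((p ++ v) ++ q)) (m+n∸n≡m (length (p ++ v)) c) ⟩
      drop (length (p ++ v)) ((p ++ v) ++ q)
        ≡⟨ drop-length-++ (p ++ v) ⟩
      q ∎
      where open ≡-Reasoning

  smallTilings : ℕ → ℕ → List (List ℕ)
  smallTilings d n = concatMap (compositions n) (applyUpTo suc (d ∸ 1))

  splicedTilings : ℕ → ℕ → ℕ → ℕ → List (List ℕ)
  splicedTilings a b c n = concatMap
    (λ k → concatMap (λ u → map (splice a u) (boundedTilings (b ∸ 1) (n ∸ k))) (compositions k (a + c)))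
    (applyUpTo (a + c +_) (suc n ∸ (a + c)))

  SmallTiling : ℕ → ℕ → List ℕ → Set
  SmallTiling d n t = ∃ λ k → k ∈ applyUpTo suc (d ∸ 1) × Tiling n t × length t ≡ k

  SplicedTiling : ℕ → ℕ → ℕ → ℕ → List ℕ → Set
  SplicedTiling a b c n t = ∃ λ k → k ∈ applyUpTo (a + c +_) (suc n ∸ (a + c)) ×
    ∃ λ u → u ∈ compositions k (a + c) × ∃ λ v → BoundedTiling (b ∸ 1) (n ∸ k) v × t ≡ splice a u v

  smallTilings-enumerates : (d n : ℕ) → Enumerates (smallTilings d n) (SmallTiling d n)
  smallTilings-enumerates d n =
    Enumerates-concatMap (compositions n) length
      (Unique.applyUpTo⁺₁ suc (d ∸ 1) (λ i<j _ → <⇒≢ (s≤s i<j)))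
      (compositions-enumerates n) (λ _ (_ , |t|≡k) → |t|≡k)

  splicedTilings-enumerates : (a b c n : ℕ) → Enumerates (splicedTilings a b c n) (SplicedTiling a b c n)
  splicedTilings-enumerates a b c n =
    Enumerates-concatMap _ (sum ∘ unsplice a c)
      (Unique.applyUpTo⁺₁ (a + c +_) _ (λ i<j _ → <⇒≢ (+-monoʳ-< (a + c) i<j)))
      (λ k → Enumerates-concatMap _ (unsplice a c) (compositions-unique k (a + c))
               (λ u → Enumerates-map (splice a u) (λ _ _ → splice-injective a u)
                                     (boundedTilings-enumerates (b ∸ 1) (n ∸ k)))
               (λ u∈ (v , _ , t≡) → trans (cong (unsplice a c) t≡)
                                          (unsplice-splice a c _ v (proj₂ (∈-compositions⁻ k (a + c) u∈)))))
      (λ _ (u , u∈ , v , _ , t≡) →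
         let (_ , Σu≡k) , |u|≡ = ∈-compositions⁻ _ _ u∈
         in trans (cong (sum ∘ unsplice a c) t≡) (trans (cong sum (unsplice-splice a c u v |u|≡)) Σu≡k))

  All-splice : {P : ℕ → Set} (a : ℕ) {u v : List ℕ} → All P u → All P v → All P (splice a u v)
  All-splice a u⁺ v⁺ = ++⁺ (take⁺ a u⁺) (++⁺ v⁺ (drop⁺ a u⁺))

  sum-splice : (a : ℕ) (u v : List ℕ) → sum (splice a u v) ≡ sum u + sum v
  sum-splice a u v = begin
    sum (take a u ++ v ++ drop a u)                   ≡⟨ sum-++ (take a u) (v ++ drop a u) ⟩
    sum (take a u) + sum (v ++ drop a u)              ≡⟨ cong (sum (take a u) +_) (sum-++ v (drop a u)) ⟩
    sum (take a u) + (sum v + sum (drop a u))         ≡⟨ cong (sum (take a u) +_) (+-comm (sum v) _) ⟩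
    sum (take a u) + (sum (drop a u) + sum v)         ≡⟨ sym (+-assoc (sum (take a u)) _ _) ⟩
    sum (take a u) + sum (drop a u) + sum v           ≡⟨ cong (_+ sum v) (sym (sum-++ (take a u) _)) ⟩
    sum (take a u ++ drop a u) + sum v                ≡⟨ cong (λ w → sum w + sum v) (take++drop≡id a u) ⟩
    sum u + sum v                                     ∎
    where open ≡-Reasoning

  ∈-prefix : {x : ℕ} (v w p q : List ℕ) → v ++ w ≡ p ++ x ∷ q → length w ≤ length q → x ∈ v
  ∈-prefix [] _ p q refl |w|≤|q| =
    ⊥-elim (<⇒≱ (≤-trans (m≤n+m (suc (length q)) (length p)) (≤-reflexive (sym (length-++ p)))) |w|≤|q|)
  ∈-prefix (y ∷ v) w [] q refl _ = here refl
  ∈-prefix (y ∷ v) w (z ∷ p) q e |w|≤|q| = there (∈-prefix v w p q (∷-injectiveʳ e) |w|≤|q|)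

  ∈-middle : {x : ℕ} (u v w p q : List ℕ) → u ++ v ++ w ≡ p ++ x ∷ q →
    length u ≤ length p → length w ≤ length q → x ∈ v
  ∈-middle [] v w p q e _ |w|≤|q| = ∈-prefix v w p q e |w|≤|q|
  ∈-middle (y ∷ u) v w (z ∷ p) q e (s≤s |u|≤|p|) |w|≤|q| = ∈-middle u v w p q (∷-injectiveʳ e) |u|≤|p| |w|≤|q|

  SplicedTiling⇒RestrictedTiling : (a b c n : ℕ) {t : List ℕ} →
    SplicedTiling a b c n t → RestrictedTiling a b c n t
  SplicedTiling⇒RestrictedTiling a b c n (k , k∈ , u , u∈ , v , (v-bounds , Σv≡) , refl)
    with ∈-applyUpTo⁻ (a + c +_) k∈ | ∈-compositions⁻ k (a + c) u∈
  ... | i , i< , refl | (u⁺ , Σu≡k) , |u|≡ =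
    (All-splice a u⁺ (All.map proj₁ v-bounds) , sum≡n) , Narrow⇒Restricted a b c _ narrow
    where
    k≤n : a + c + i ≤ n
    k≤n = ≤-pred (<∸⇒+< (a + c) i<)
    sum≡n : sum (splice a u v) ≡ n
    sum≡n = trans (sum-splice a u v) (trans (cong₂ _+_ Σu≡k Σv≡) (m+[n∸m]≡n k≤n))
    narrow : Narrow a b c (splice a u v)
    narrow p x q e a≤p c≤q = proj₂ (All.lookup v-bounds (∈-middle (take a u) v (drop a u) p q e
      (≤-trans (≤-reflexive (length-take a u)) (≤-trans (m⊓n≤m a _) a≤p))
      (≤-trans (≤-reflexive (trans (length-drop a u) (trans (cong (_∸ a) |u|≡) (m+n∸m≡n a c)))) c≤q)))

  SmallTiling⇒RestrictedTiling : (a b c n : ℕ) {t : List ℕ} →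
    SmallTiling (a + c) n t → RestrictedTiling a b c n t
  SmallTiling⇒RestrictedTiling a b c n {t} (k , k∈ , tiling , |t|≡k) with ∈-applyUpTo⁻ suc k∈
  ... | i , i< , refl = tiling , Narrow⇒Restricted a b c t narrow
    where
    narrow : Narrow a b c t
    narrow p x q t≡ a≤p c≤q = ⊥-elim (<⇒≱ (<∸⇒+< 1 i<) (begin
      a + c                     ≤⟨ +-mono-≤ a≤p (m≤n⇒m≤1+n c≤q) ⟩
      length p + length (x ∷ q) ≡⟨ sym (length-++ p) ⟩
      length (p ++ x ∷ q)       ≡⟨ cong length (sym t≡) ⟩
      length t                  ≡⟨ |t|≡k ⟩
      suc i                     ∎))
      where open ≤-Reasoning

  split-outer : (a c : ℕ) (t : List ℕ) → a + c ≤ length t →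
    ∃₂ λ p v → ∃ λ q → t ≡ p ++ v ++ q × length p ≡ a × length q ≡ c
  split-outer a c t a+c≤t with splitAt-length a t (≤-trans (m≤m+n a c) a+c≤t)
  ... | p , w , refl , refl with splitAt-length (length w ∸ c) w (m∸n≤m (length w) c)
  ...   | v , q , refl , |v|≡ = p , v , q , refl , refl ,
    +-cancelˡ-≡ (length v) _ _ (begin
      length v + length q    ≡⟨ sym (length-++ v) ⟩
      length (v ++ q)        ≡⟨ sym (m+[n∸m]≡n c≤w) ⟩
      c + (length (v ++ q) ∸ c) ≡⟨ +-comm c _ ⟩
      (length (v ++ q) ∸ c) + c ≡⟨ cong (_+ c) (sym |v|≡) ⟩
      length v + c           ∎)
    where
    open ≡-Reasoning
    c≤w : c ≤ length (v ++ q)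
    c≤w = +-cancelˡ-≤ (length p) c _ (≤-trans a+c≤t (≤-reflexive (length-++ p)))

  RestrictedTiling⇒SplicedTiling : (a b c n : ℕ) {t : List ℕ} → a + c ≤ length t →
    RestrictedTiling a b c n t → SplicedTiling a b c n t
  RestrictedTiling⇒SplicedTiling a b c n {t} a+c≤t ((t⁺ , Σt≡n) , restricted)
    with split-outer a c t a+c≤t
  ... | p , v , q , refl , refl , refl =
    sum (p ++ q) , k∈ , p ++ q , u∈ , v , (v-bounds , Σv≡) , sym (splice-++ p q v refl)
    where
    pq⁺ : All (1 ≤_) (p ++ q)
    pq⁺ = ++⁺ (++⁻ˡ p t⁺) (++⁻ʳ v (++⁻ʳ p t⁺))
    |pq|≡ : length (p ++ q) ≡ length p + length q
    |pq|≡ = length-++ p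
    u∈ : p ++ q ∈ compositions (sum (p ++ q)) (length p + length q)
    u∈ = subst (λ k → p ++ q ∈ compositions (sum (p ++ q)) k) |pq|≡
               (∈-compositions⁺ (sum (p ++ q)) (pq⁺ , refl))
    Σt≡ : sum (p ++ v ++ q) ≡ sum (p ++ q) + sum v
    Σt≡ = trans (cong sum (sym (splice-++ p q v refl))) (sum-splice (length p) (p ++ q) v)
    d≤k : length p + length q ≤ sum (p ++ q)
    d≤k = ≤-trans (≤-reflexive (sym |pq|≡)) (length≤sum pq⁺)
    k≤n : sum (p ++ q) ≤ n
    k≤n = ≤-trans (m≤m+n _ (sum v)) (≤-reflexive (trans (sym Σt≡) Σt≡n))
    k∈ : sum (p ++ q) ∈ applyUpTo (length p + length q +_) (suc n ∸ (length p + length q))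
    k∈ = subst (_∈ applyUpTo (length p + length q +_) (suc n ∸ (length p + length q)))
               (m+[n∸m]≡n d≤k)
               (∈-applyUpTo⁺ (length p + length q +_)
                 (m+n≤o⇒m≤o∸n (suc (sum (p ++ q) ∸ (length p + length q)))
                   (s≤s (≤-trans (≤-reflexive (m∸n+n≡m d≤k)) k≤n))))
    Σv≡ : sum v ≡ n ∸ sum (p ++ q)
    Σv≡ = sym (trans (cong (_∸ sum (p ++ q)) (trans (sym Σt≡n) Σt≡)) (m+n∸m≡n (sum (p ++ q)) (sum v)))
    v-bounds : All (λ x → 1 ≤ x × x ≤ b ∸ 1) v
    v-bounds = All.tabulate λ {x} x∈v → All.lookup (++⁻ˡ v (++⁻ʳ p t⁺)) x∈v ,
      (let v₁ , v₂ , v≡ = ∈-∃++ x∈v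
       in Restricted⇒Narrow a b c _ restricted (p ++ v₁) x (v₂ ++ q)
            (trans (cong (λ w → p ++ w ++ q) v≡) (trans (cong (p ++_) (++-assoc v₁ (x ∷ v₂) q))
                                                        (sym (++-assoc p v₁ (x ∷ v₂ ++ q)))))
            (length-mono-≤ (++⁺ʳ v₁ (⊆-refl {x = p})))
            (length-mono-≤ (++⁺ˡ v₂ (⊆-refl {x = q}))))

  restrictedTilings : ℕ → ℕ → ℕ → ℕ → List (List ℕ)
  restrictedTilings a b c n = smallTilings (a + c) n ++ splicedTilings a b c n

  restrictedTilings-enumerates : (a b c n : ℕ) → 1 ≤ n →
    Enumerates (restrictedTilings a b c n) (RestrictedTiling a b c n)
  restrictedTilings-enumerates a b c n 1≤n =
    Enumerates-resp-⇔
      (λ t → mk⇔ Sum.[ SmallTiling⇒RestrictedTiling a b c n , SplicedTiling⇒RestrictedTiling a b c n ]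
                 (small-or-spliced t))
      (Enumerates-++ (smallTilings-enumerates (a + c) n) (splicedTilings-enumerates a b c n) disjoint)
    where
    disjoint : ∀ {t} → SmallTiling (a + c) n t → SplicedTiling a b c n t → ⊥
    disjoint (k , k∈ , _ , refl) (k′ , _ , u , u∈ , v , _ , refl) with ∈-applyUpTo⁻ suc k∈
    ... | i , i< , |t|≡ = <⇒≱ (<∸⇒+< 1 i<) (begin
      a + c                            ≡⟨ sym (proj₂ (∈-compositions⁻ k′ (a + c) u∈)) ⟩
      length u                         ≡⟨ cong length (sym (take++drop≡id a u)) ⟩
      length (take a u ++ drop a u)    ≤⟨ length-mono-≤ (⊆-++⁺ (⊆-refl {x = take a u}) (++⁺ˡ v ⊆-refl)) ⟩
      length (splice a u v)            ≡⟨ |t|≡ ⟩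
      suc i                            ∎)
      where open ≤-Reasoning
    small-or-spliced : ∀ t → RestrictedTiling a b c n t → SmallTiling (a + c) n t ⊎ SplicedTiling a b c n t
    small-or-spliced t tiling with length t <? a + c
    ... | no t≮d = inj₂ (RestrictedTiling⇒SplicedTiling a b c n (≮⇒≥ t≮d) tiling)
    small-or-spliced [] ((_ , refl) , _) | yes _ = ⊥-elim (<⇒≱ 1≤n z≤n)
    small-or-spliced (x ∷ t) (tiling , _) | yes t<d =
      inj₁ (suc (length t) ,
            ∈-applyUpTo⁺ suc (m+n≤o⇒m≤o∸n (suc (length t)) (≤-trans (≤-reflexive (+-comm _ 1)) t<d)) ,
            tiling , refl)

  length-smallTilings : (d n : ℕ) →
    length (smallTilings d (suc n)) ≡ sumRange 1 (d ∸ 1) (λ k → (suc n ∸ 1) C (k ∸ 1))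
  length-smallTilings d n = begin
    length (concatMap (compositions (suc n)) (applyUpTo suc (d ∸ 1)))
      ≡⟨ length-concatMap (compositions (suc n)) (applyUpTo suc (d ∸ 1)) ⟩
    sum (map (length ∘ compositions (suc n)) (applyUpTo suc (d ∸ 1)))
      ≡⟨ cong sum (map-applyUpTo suc (length ∘ compositions (suc n)) (d ∸ 1)) ⟩
    sum (applyUpTo (length ∘ compositions (suc n) ∘ suc) (d ∸ 1))
      ≡⟨ cong sum (applyUpTo-cong (λ i → length-compositions (suc n) (suc i) (s≤s z≤n) (s≤s z≤n)) (d ∸ 1)) ⟩
    sum (applyUpTo (n C_) (d ∸ 1))
      ≡⟨ cong sum (sym (map-upTo (n C_) (d ∸ 1))) ⟩
    sumRange 1 (d ∸ 1) (λ k → (suc n ∸ 1) C (k ∸ 1)) ∎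
    where open ≡-Reasoning

  length-splicedTilings : (a b c n : ℕ) → 1 ≤ a + c →
    length (splicedTilings a b c n) ≡
    sumRange (a + c) n (λ k → ((k ∸ 1) C (a + c ∸ 1)) * fib (b ∸ 1) (n ∸ k + 1))
  length-splicedTilings a b c n 1≤d = begin
    length (concatMap spliced (applyUpTo (d +_) (suc n ∸ d)))
      ≡⟨ length-concatMap spliced (applyUpTo (d +_) (suc n ∸ d)) ⟩
    sum (map (length ∘ spliced) (applyUpTo (d +_) (suc n ∸ d)))
      ≡⟨ cong sum (map-applyUpTo (d +_) (length ∘ spliced) (suc n ∸ d)) ⟩
    sum (applyUpTo (λ i → length (spliced (d + i))) (suc n ∸ d))
      ≡⟨ cong sum (applyUpTo-cong (λ i → length-spliced (d + i) (≤-trans 1≤d (m≤m+n d i))) (suc n ∸ d)) ⟩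
    sum (applyUpTo (λ i → summand (d + i)) (suc n ∸ d))
      ≡⟨ cong sum (sym (map-upTo (λ i → summand (d + i)) (suc n ∸ d))) ⟩
    sumRange d n summand ∎
    where
    open ≡-Reasoning
    d = a + c
    spliced : ℕ → List (List ℕ)
    spliced k = concatMap (λ u → map (splice a u) (boundedTilings (b ∸ 1) (n ∸ k))) (compositions k d)
    summand : ℕ → ℕ
    summand k = ((k ∸ 1) C (d ∸ 1)) * fib (b ∸ 1) (n ∸ k + 1)
    length-spliced : ∀ k → 1 ≤ k → length (spliced k) ≡ summand k
    length-spliced k 1≤k = begin
      length (spliced k)
        ≡⟨ length-concatMap (λ u → map (splice a u) (boundedTilings (b ∸ 1) (n ∸ k))) (compositions k d) ⟩
      sum (map (λ u → length (map (splice a u) (boundedTilings (b ∸ 1) (n ∸ k)))) (compositions k d))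
        ≡⟨ cong sum (map-cong (λ u → length-map (splice a u) (boundedTilings (b ∸ 1) (n ∸ k)))
                              (compositions k d)) ⟩
      sum (map (λ _ → length (boundedTilings (b ∸ 1) (n ∸ k))) (compositions k d))
        ≡⟨ sum-map-const _ (compositions k d) ⟩
      length (compositions k d) * length (boundedTilings (b ∸ 1) (n ∸ k))
        ≡⟨ cong₂ _*_ (length-compositions k d 1≤k 1≤d)
                     (trans (length-boundedTilings (b ∸ 1) (n ∸ k)) (cong (fib (b ∸ 1)) (+-comm 1 (n ∸ k)))) ⟩
      summand k ∎

  S-enumerates : (a b c n : ℕ) → 1 ≤ b → 1 ≤ n →
    Enumerates (map layered (restrictedTilings a b c n)) (S n (patterns a b c))
  S-enumerates a b c n 1≤b 1≤n =
    Enumerates-resp-⇔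
      (λ π → mk⇔ (λ (t , tiling , π≡) → subst (S n (patterns a b c)) (sym π≡) (layered∈S a b c 1≤b tiling))
                 (S⇒layered a b c))
      (Enumerates-map layered (λ ((t⁺ , _) , _) ((t′⁺ , _) , _) → layered-injective t⁺ t′⁺)
                      (restrictedTilings-enumerates a b c n 1≤n))

  S-hasCard : (a b c n : ℕ) → 1 ≤ a + c → 1 ≤ b → 1 ≤ n →
    HasCard (S n (patterns a b c)) (countFormula a b c n)
  S-hasCard a b c (suc n) 1≤d 1≤b 1≤n =
    subst (HasCard (S (suc n) (patterns a b c))) length≡
          (Enumerates⇒HasCard (S-enumerates a b c (suc n) 1≤b 1≤n))
    where
    open ≡-Reasoning
    length≡ : length (map layered (restrictedTilings a b c (suc n))) ≡ countFormula a b c (suc n)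
    length≡ = begin
      length (map layered (restrictedTilings a b c (suc n)))
        ≡⟨ length-map layered (restrictedTilings a b c (suc n)) ⟩
      length (smallTilings (a + c) (suc n) ++ splicedTilings a b c (suc n))
        ≡⟨ length-++ (smallTilings (a + c) (suc n)) ⟩
      length (smallTilings (a + c) (suc n)) + length (splicedTilings a b c (suc n))
        ≡⟨ cong₂ _+_ (length-smallTilings (a + c) n) (length-splicedTilings a b c (suc n) 1≤d) ⟩
      countFormula a b c (suc n) ∎

  S₀-hasCard : (a b c : ℕ) → 1 ≤ b → HasCard (S 0 (patterns a b c)) 1
  S₀-hasCard a b c 1≤b =
    [] ∷ [] , [] ∷ [] ,
    (λ π → mk⇔ (λ { (here refl) → layered∈S a b c 1≤b (([] , refl) , λ ()) })
               (λ { ((|π|≡0 , _) , _) → here (empty |π|≡0) })) ,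
    refl
    where
    empty : ∀ {π : List ℕ} → length π ≡ 0 → π ≡ []
    empty {[]} _ = refl

module PowerSeries where
  open import Defs
  open import Data.Bool using (if_then_else_)
  open import Data.Integer using (ℤ; +_; -_; _+_; _*_; _-_)
  import Data.Integer.Properties as ℤ
  open import Data.Integer.Tactic.RingSolver using (solve-∀)
  open import Data.List using (List; []; _∷_; map; upTo; applyUpTo; applyDownFrom; take)
  open import Data.List.Properties using (map-applyUpTo; map-upTo; take-map; take-[])
  open import Data.Nat as ℕ using (ℕ; zero; suc)
  open import Data.Nat.Combinatorics using (_C_; nCk+nC[k+1]≡[n+1]C[k+1])
  open import Data.Nat.Combinatorics.Specification using (k>n⇒nCk≡0)
  open import Data.Nat.ListAction using (sum)
  import Data.Nat.Properties as ℕ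
  open import Function.Base using (_∘_)
  open import Relation.Binary.Bundles using (Setoid)
  open import Relation.Binary.PropositionalEquality
  import Relation.Binary.Reasoning.Setoid as SetoidReasoning
  open LayeredPermutations using (nC0≡1; applyUpTo-cong)

  infix 4 _≐_

  _≐_ : Series → Series → Set
  f ≐ g = ∀ n → f n ≡ g n

  ≐-refl : {f : Series} → f ≐ f
  ≐-refl n = refl

  ≐-sym : {f g : Series} → f ≐ g → g ≐ f
  ≐-sym f≐g n = sym (f≐g n)

  ≐-trans : {f g h : Series} → f ≐ g → g ≐ h → f ≐ h
  ≐-trans f≐g g≐h n = trans (f≐g n) (g≐h n)

  ≐-setoid : Setoid _ _
  ≐-setoid = record
    { Carrier = Series ; _≈_ = _≐_
    ; isEquivalence = record { refl = ≐-refl ; sym = ≐-sym ; trans = ≐-trans } }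

  module ≐-Reasoning = SetoidReasoning ≐-setoid

  0ˢ : Series
  0ˢ _ = + 0

  tailˢ : Series → Series
  tailˢ f n = f (suc n)

  timesX : Series → Series
  timesX f zero = + 0
  timesX f (suc n) = f n

  conv : Series → Series → Series
  conv f g zero = f 0 * g 0
  conv f g (suc n) = f 0 * g (suc n) + conv (tailˢ f) g n

  ⊛≐conv : (f g : Series) → f ⊛ g ≐ conv f g
  ⊛≐conv f g n = trans (cong sumℤ (map-applyUpTo (λ k → k) (λ k → f k * g (n ℕ.∸ k)) (suc n)))
                       (sum≡conv f n)
    where
    sum≡conv : (f : Series) (n : ℕ) → sumℤ (applyUpTo (λ k → f k * g (n ℕ.∸ k)) (suc n)) ≡ conv f g n
    sum≡conv f zero = ℤ.+-identityʳ _
    sum≡conv f (suc n) = cong (λ z → f 0 * g (suc n) + z) (sum≡conv (tailˢ f) n)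

  conv-cong : {f f′ g g′ : Series} → f ≐ f′ → g ≐ g′ → conv f g ≐ conv f′ g′
  conv-cong f≐ g≐ zero = cong₂ _*_ (f≐ 0) (g≐ 0)
  conv-cong f≐ g≐ (suc n) = cong₂ _+_ (cong₂ _*_ (f≐ 0) (g≐ (suc n))) (conv-cong (f≐ ∘ suc) g≐ n)

  conv-last : (f g : Series) (n : ℕ) → conv f g (suc n) ≡ conv f (tailˢ g) n + f (suc n) * g 0
  conv-last f g zero = refl
  conv-last f g (suc n) = trans (cong (λ z → f 0 * g (suc (suc n)) + z) (conv-last (tailˢ f) g n))
    (sym (ℤ.+-assoc (f 0 * g (suc (suc n))) (conv (tailˢ f) (tailˢ g) n) (f (suc (suc n)) * g 0)))

  conv-comm : (f g : Series) → conv f g ≐ conv g f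
  conv-comm f g zero = ℤ.*-comm (f 0) (g 0)
  conv-comm f g (suc n) = trans (cong (λ z → f 0 * g (suc n) + z) (conv-comm (tailˢ f) g n))
    (trans (rearrange (f 0) (g (suc n)) (conv g (tailˢ f) n)) (sym (conv-last g f n)))
    where
    rearrange : ∀ a b c → a * b + c ≡ c + b * a
    rearrange = solve-∀

  conv-linearˡ : (α : ℤ) (f f′ g : Series) →
    conv (λ k → α * f k + f′ k) g ≐ (λ n → α * conv f g n + conv f′ g n)
  conv-linearˡ α f f′ g zero = distrib α (f 0) (f′ 0) (g 0)
    where
    distrib : ∀ a x y z → (a * x + y) * z ≡ a * (x * z) + y * z
    distrib = solve-∀
  conv-linearˡ α f f′ g (suc n) =
    trans (cong (λ z → (α * f 0 + f′ 0) * g (suc n) + z) (conv-linearˡ α (tailˢ f) (tailˢ f′) g n))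
          (distrib α (f 0) (f′ 0) (g (suc n)) (conv (tailˢ f) g n) (conv (tailˢ f′) g n))
    where
    distrib : ∀ a x y z u v → (a * x + y) * z + (a * u + v) ≡ a * (x * z + u) + (y * z + v)
    distrib = solve-∀

  conv-assoc : (f g h : Series) → conv (conv f g) h ≐ conv f (conv g h)
  conv-assoc f g h zero = ℤ.*-assoc (f 0) (g 0) (h 0)
  conv-assoc f g h (suc n) = begin
    (f 0 * g 0) * h (suc n) + conv (λ k → f 0 * tailˢ g k + conv (tailˢ f) g k) h n
      ≡⟨ cong (λ z → (f 0 * g 0) * h (suc n) + z) (conv-linearˡ (f 0) (tailˢ g) (conv (tailˢ f) g) h n) ⟩
    (f 0 * g 0) * h (suc n) + (f 0 * conv (tailˢ g) h n + conv (conv (tailˢ f) g) h n)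
      ≡⟨ cong (λ z → (f 0 * g 0) * h (suc n) + (f 0 * conv (tailˢ g) h n + z)) (conv-assoc (tailˢ f) g h n) ⟩
    (f 0 * g 0) * h (suc n) + (f 0 * conv (tailˢ g) h n + conv (tailˢ f) (conv g h) n)
      ≡⟨ factor (f 0) (g 0) (h (suc n)) (conv (tailˢ g) h n) (conv (tailˢ f) (conv g h) n) ⟩
    f 0 * (g 0 * h (suc n) + conv (tailˢ g) h n) + conv (tailˢ f) (conv g h) n ∎
    where
    open ≡-Reasoning
    factor : ∀ a b c d e → (a * b) * c + (a * d + e) ≡ a * (b * c + d) + e
    factor = solve-∀

  conv-zeroˡ : (g : Series) → conv 0ˢ g ≐ 0ˢ
  conv-zeroˡ g zero = refl
  conv-zeroˡ g (suc n) = trans (ℤ.+-identityˡ _) (conv-zeroˡ g n)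

  conv-identityˡ : (g : Series) → conv 𝟙 g ≐ g
  conv-identityˡ g zero = ℤ.*-identityˡ (g 0)
  conv-identityˡ g (suc n) = begin
    + 1 * g (suc n) + conv (tailˢ 𝟙) g n ≡⟨ cong (λ z → + 1 * g (suc n) + z) (conv-cong tail𝟙≐0 ≐-refl n) ⟩
    + 1 * g (suc n) + conv 0ˢ g n       ≡⟨ cong (λ z → + 1 * g (suc n) + z) (conv-zeroˡ g n) ⟩
    + 1 * g (suc n) + + 0               ≡⟨ ℤ.+-identityʳ _ ⟩
    + 1 * g (suc n)                     ≡⟨ ℤ.*-identityˡ (g (suc n)) ⟩
    g (suc n)                           ∎
    where
    open ≡-Reasoning
    tail𝟙≐0 : tailˢ 𝟙 ≐ 0ˢ
    tail𝟙≐0 _ = refl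

  ⊛-cong : {f f′ g g′ : Series} → f ≐ f′ → g ≐ g′ → f ⊛ g ≐ f′ ⊛ g′
  ⊛-cong {f} {f′} {g} {g′} f≐ g≐ n = trans (⊛≐conv f g n) (trans (conv-cong f≐ g≐ n) (sym (⊛≐conv f′ g′ n)))

  ⊛-congˡ : {f f′ : Series} (g : Series) → f ≐ f′ → f ⊛ g ≐ f′ ⊛ g
  ⊛-congˡ g f≐ = ⊛-cong f≐ (≐-refl {g})

  ⊛-congʳ : (f : Series) {g g′ : Series} → g ≐ g′ → f ⊛ g ≐ f ⊛ g′
  ⊛-congʳ f g≐ = ⊛-cong (≐-refl {f}) g≐

  ⊕-cong : {f f′ g g′ : Series} → f ≐ f′ → g ≐ g′ → f ⊕ g ≐ f′ ⊕ g′
  ⊕-cong f≐ g≐ n = cong₂ _+_ (f≐ n) (g≐ n)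

  ⊕-congˡ : {f f′ : Series} (g : Series) → f ≐ f′ → f ⊕ g ≐ f′ ⊕ g
  ⊕-congˡ g f≐ = ⊕-cong f≐ (≐-refl {g})

  ⊕-congʳ : (f : Series) {g g′ : Series} → g ≐ g′ → f ⊕ g ≐ f ⊕ g′
  ⊕-congʳ f g≐ = ⊕-cong (≐-refl {f}) g≐

  ⊛-comm : (f g : Series) → f ⊛ g ≐ g ⊛ f
  ⊛-comm f g n = trans (⊛≐conv f g n) (trans (conv-comm f g n) (sym (⊛≐conv g f n)))

  ⊛-assoc : (f g h : Series) → (f ⊛ g) ⊛ h ≐ f ⊛ (g ⊛ h)
  ⊛-assoc f g h n = begin
    ((f ⊛ g) ⊛ h) n     ≡⟨ ⊛≐conv (f ⊛ g) h n ⟩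
    conv (f ⊛ g) h n    ≡⟨ conv-cong (⊛≐conv f g) ≐-refl n ⟩
    conv (conv f g) h n ≡⟨ conv-assoc f g h n ⟩
    conv f (conv g h) n ≡⟨ conv-cong ≐-refl (≐-sym (⊛≐conv g h)) n ⟩
    conv f (g ⊛ h) n    ≡⟨ sym (⊛≐conv f (g ⊛ h) n) ⟩
    (f ⊛ (g ⊛ h)) n     ∎
    where open ≡-Reasoning

  ⊛-distribʳ : (f f′ g : Series) → (f ⊕ f′) ⊛ g ≐ (f ⊛ g) ⊕ (f′ ⊛ g)
  ⊛-distribʳ f f′ g n = begin
    ((f ⊕ f′) ⊛ g) n                          ≡⟨ ⊛≐conv (f ⊕ f′) g n ⟩
    conv (f ⊕ f′) g n
      ≡⟨ conv-cong (λ k → cong (_+ f′ k) (sym (ℤ.*-identityˡ (f k)))) ≐-refl n ⟩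
    conv (λ k → + 1 * f k + f′ k) g n         ≡⟨ conv-linearˡ (+ 1) f f′ g n ⟩
    + 1 * conv f g n + conv f′ g n            ≡⟨ cong (_+ conv f′ g n) (ℤ.*-identityˡ (conv f g n)) ⟩
    conv f g n + conv f′ g n                  ≡⟨ sym (cong₂ _+_ (⊛≐conv f g n) (⊛≐conv f′ g n)) ⟩
    ((f ⊛ g) ⊕ (f′ ⊛ g)) n                    ∎
    where open ≡-Reasoning

  ⊛-distribˡ : (f g g′ : Series) → f ⊛ (g ⊕ g′) ≐ (f ⊛ g) ⊕ (f ⊛ g′)
  ⊛-distribˡ f g g′ =
    ≐-trans (⊛-comm f (g ⊕ g′)) (≐-trans (⊛-distribʳ g g′ f) (⊕-cong (⊛-comm g f) (⊛-comm g′ f)))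

  ⊛-identityˡ : (g : Series) → 𝟙 ⊛ g ≐ g
  ⊛-identityˡ g n = trans (⊛≐conv 𝟙 g n) (conv-identityˡ g n)

  ⊛-identityʳ : (g : Series) → g ⊛ 𝟙 ≐ g
  ⊛-identityʳ g = ≐-trans (⊛-comm g 𝟙) (⊛-identityˡ g)

  ⊛-zeroʳ : (g : Series) → g ⊛ 0ˢ ≐ 0ˢ
  ⊛-zeroʳ g n = trans (⊛-comm g 0ˢ n) (trans (⊛≐conv 0ˢ g n) (conv-zeroˡ g n))

  ⊛-swap : (f g h : Series) → f ⊛ (g ⊛ h) ≐ g ⊛ (f ⊛ h)
  ⊛-swap f g h = ≐-trans (≐-sym (⊛-assoc f g h)) (≐-trans (⊛-congˡ h (⊛-comm f g)) (⊛-assoc g f h))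

  ⊕-comm : (f g : Series) → f ⊕ g ≐ g ⊕ f
  ⊕-comm f g n = ℤ.+-comm (f n) (g n)

  ⊕-assoc : (f g h : Series) → (f ⊕ g) ⊕ h ≐ f ⊕ (g ⊕ h)
  ⊕-assoc f g h n = ℤ.+-assoc (f n) (g n) (h n)

  ⊕-identityʳ : (f : Series) → f ⊕ 0ˢ ≐ f
  ⊕-identityʳ f n = ℤ.+-identityʳ (f n)

  X^0≐𝟙 : X^ 0 ≐ 𝟙
  X^0≐𝟙 zero = refl
  X^0≐𝟙 (suc n) = refl

  timesX-cong : {f f′ : Series} → f ≐ f′ → timesX f ≐ timesX f′
  timesX-cong f≐ zero = refl
  timesX-cong f≐ (suc n) = f≐ n

  X⊛≐timesX : (g : Series) → X^ 1 ⊛ g ≐ timesX g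
  X⊛≐timesX g n = trans (⊛≐conv (X^ 1) g n) (trans (conv-X g n)
                        (timesX-cong (λ k → trans (conv-cong X^0≐𝟙 ≐-refl k) (conv-identityˡ g k)) n))
    where
    conv-X : (g : Series) → conv (X^ 1) g ≐ timesX (conv (X^ 0) g)
    conv-X g zero = refl
    conv-X g (suc n) = ℤ.+-identityˡ _

  X^-suc : (m : ℕ) → X^ (suc m) ≐ X^ 1 ⊛ X^ m
  X^-suc m n = sym (trans (X⊛≐timesX (X^ m) n) (timesX-X^ n))
    where
    timesX-X^ : timesX (X^ m) ≐ X^ (suc m)
    timesX-X^ zero = refl
    timesX-X^ (suc n) = refl

  ⊛-applyUpTo : (f g : Series) (n : ℕ) → (f ⊛ g) n ≡ sumℤ (applyUpTo (λ k → f k * g (n ℕ.∸ k)) (suc n))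
  ⊛-applyUpTo f g n = cong sumℤ (map-applyUpTo (λ k → k) (λ k → f k * g (n ℕ.∸ k)) (suc n))

  +-sum-applyUpTo : (h : ℕ → ℕ) (m : ℕ) → + sum (applyUpTo h m) ≡ sumℤ (applyUpTo (+_ ∘ h) m)
  +-sum-applyUpTo h zero = refl
  +-sum-applyUpTo h (suc m) =
    trans (ℤ.pos-+ (h 0) _) (cong (λ z → + h 0 + z) (+-sum-applyUpTo (h ∘ suc) m))

  sumℤ-applyUpTo-drop : (d : ℕ) (h : ℕ → ℤ) (m : ℕ) → (∀ k → k ℕ.< d → h k ≡ + 0) →
    sumℤ (applyUpTo h m) ≡ sumℤ (applyUpTo (λ i → h (d ℕ.+ i)) (m ℕ.∸ d))
  sumℤ-applyUpTo-drop zero h m _ = refl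
  sumℤ-applyUpTo-drop (suc d) h zero _ = refl
  sumℤ-applyUpTo-drop (suc d) h (suc m) h≡0 =
    trans (cong (_+ sumℤ (applyUpTo (h ∘ suc) m)) (h≡0 0 (ℕ.s≤s ℕ.z≤n)))
          (trans (ℤ.+-identityˡ _) (sumℤ-applyUpTo-drop d (h ∘ suc) m (λ k k<d → h≡0 (suc k) (ℕ.s≤s k<d))))

  oneMinusX⊛-zero : (g : Series) → (oneMinusX ⊛ g) 0 ≡ g 0
  oneMinusX⊛-zero g = trans (⊛≐conv oneMinusX g 0) (ℤ.*-identityˡ (g 0))

  oneMinusX⊛-suc : (g : Series) (n : ℕ) → (oneMinusX ⊛ g) (suc n) ≡ g (suc n) - g n
  oneMinusX⊛-suc g n = trans (⊛≐conv oneMinusX g (suc n)) (difference n)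
    where
    difference : (n : ℕ) → conv oneMinusX g (suc n) ≡ g (suc n) - g n
    difference zero = cong₂ _+_ (ℤ.*-identityˡ (g 1)) (ℤ.-1*i≡-i (g 0))
    difference (suc n) = begin
      + 1 * g (suc (suc n)) + (- (+ 1) * g (suc n) + conv (tailˢ (tailˢ oneMinusX)) g n)
        ≡⟨ cong₂ (λ x y → x + (- (+ 1) * g (suc n) + y)) (ℤ.*-identityˡ (g (suc (suc n))))
                 (trans (conv-cong {f′ = 0ˢ} (λ _ → refl) ≐-refl n) (conv-zeroˡ g n)) ⟩
      g (suc (suc n)) + (- (+ 1) * g (suc n) + + 0)
        ≡⟨ cong (λ z → g (suc (suc n)) + z) (trans (ℤ.+-identityʳ _) (ℤ.-1*i≡-i (g (suc n)))) ⟩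
      g (suc (suc n)) - g (suc n) ∎
      where open ≡-Reasoning

  -- (x / (1 - x))^k: the coefficient of x^n counts the compositions of n into k parts
  binomialSeries : ℕ → Series
  binomialSeries zero = 𝟙
  binomialSeries (suc k) zero = + 0
  binomialSeries (suc k) (suc n) = + (n C k)

  oneMinusX⊛binomialSeries : (k : ℕ) → oneMinusX ⊛ binomialSeries (suc k) ≐ X^ 1 ⊛ binomialSeries k
  oneMinusX⊛binomialSeries k zero =
    trans (oneMinusX⊛-zero (binomialSeries (suc k))) (sym (X⊛≐timesX (binomialSeries k) 0))
  oneMinusX⊛binomialSeries k (suc n) =
    trans (oneMinusX⊛-suc (binomialSeries (suc k)) n)
          (trans (pascal k n) (sym (X⊛≐timesX (binomialSeries k) (suc n))))
    where
    cancel : ∀ a b → (a + b) - b ≡ a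
    cancel = solve-∀
    pascal : (k n : ℕ) → binomialSeries (suc k) (suc n) - binomialSeries (suc k) n ≡ binomialSeries k n
    pascal zero zero = refl
    pascal (suc k) zero = refl
    pascal zero (suc n) = cong₂ (λ x y → + x - + y) (nC0≡1 (suc n)) (nC0≡1 n)
    pascal (suc k) (suc n) = begin
      + (suc n C suc k) - + (n C suc k)
        ≡⟨ cong (λ z → + z - + (n C suc k)) (sym (nCk+nC[k+1]≡[n+1]C[k+1] n k)) ⟩
      + (n C k ℕ.+ n C suc k) - + (n C suc k)      ≡⟨ cong (_- + (n C suc k)) (ℤ.pos-+ (n C k) (n C suc k)) ⟩
      (+ (n C k) + + (n C suc k)) - + (n C suc k)  ≡⟨ cancel (+ (n C k)) (+ (n C suc k)) ⟩
      + (n C k)                                    ∎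
      where open ≡-Reasoning

  oneMinusX⊛fibDen : (b : ℕ) → 1 ℕ.≤ b → (oneMinusX ⊛ fibDen b) ⊕ X^ 1 ≐ oneMinusX ⊕ X^ b
  oneMinusX⊛fibDen (suc b) _ zero = cong (_+ + 0) (oneMinusX⊛-zero (fibDen (suc b)))
  oneMinusX⊛fibDen (suc zero) _ (suc zero) = cong (_+ + 1) (oneMinusX⊛-suc (fibDen 1) 0)
  oneMinusX⊛fibDen (suc (suc b)) _ (suc zero) = cong (_+ + 1) (oneMinusX⊛-suc (fibDen (suc (suc b))) 0)
  oneMinusX⊛fibDen (suc b) _ (suc (suc m)) =
    trans (cong (_+ + 0) (oneMinusX⊛-suc (fibDen (suc b)) (suc m)))
          (trans (ℤ.+-identityʳ _) (trans (step m b) (sym (ℤ.+-identityˡ _))))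
    where
    step : (m b : ℕ) → (if suc m ℕ.<ᵇ b then - (+ 1) else + 0) - (if m ℕ.<ᵇ b then - (+ 1) else + 0)
                     ≡ (if suc m ℕ.≡ᵇ b then + 1 else + 0)
    step m zero = refl
    step zero (suc zero) = refl
    step zero (suc (suc b)) = refl
    step (suc m) (suc b) = step m b

  -- ∑ F_{B,m+1} x^m, the inverse of 1 - x - ⋯ - x^B
  fibSeries : ℕ → Series
  fibSeries B m = + fib B (suc m)

  sumℤ-map-+ : (xs : List ℕ) → sumℤ (map +_ xs) ≡ + sum xs
  sumℤ-map-+ [] = refl
  sumℤ-map-+ (x ∷ xs) = trans (cong (λ z → + x + z) (sumℤ-map-+ xs)) (sym (ℤ.pos-+ x (sum xs)))

  fibSeries⊛fibDen : (b : ℕ) → fibSeries (b ℕ.∸ 1) ⊛ fibDen b ≐ 𝟙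
  fibSeries⊛fibDen b n = trans (⊛-comm (fibSeries B) (fibDen b) n)
                               (trans (⊛≐conv (fibDen b) (fibSeries B) n) (coefficient n))
    where
    B = b ℕ.∸ 1
    fibDenTail : ℕ → Series
    fibDenTail K = tailˢ (fibDen K)
    conv-fibDenTail : (K : ℕ) (h : Series) (n : ℕ) →
      conv (fibDenTail K) h n ≡ - sumℤ (take (K ℕ.∸ 1) (applyDownFrom h (suc n)))
    conv-fibDenTail zero h zero = refl
    conv-fibDenTail (suc zero) h zero = refl
    conv-fibDenTail (suc (suc K)) h zero = trans (ℤ.-1*i≡-i (h 0))
      (cong -_ (sym (trans (cong (λ xs → h 0 + sumℤ xs) (take-[] K)) (ℤ.+-identityʳ (h 0)))))
    conv-fibDenTail K h (suc n) =
      trans (cong (λ z → fibDenTail K 0 * h (suc n) + z)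
                  (trans (conv-cong (tail-fibDenTail K) ≐-refl n) (conv-fibDenTail (ℕ.pred K) h n)))
            (step K)
      where
      tail-fibDenTail : (K : ℕ) → tailˢ (fibDenTail K) ≐ fibDenTail (ℕ.pred K)
      tail-fibDenTail zero _ = refl
      tail-fibDenTail (suc K) _ = refl
      negate : ∀ x y → - (+ 1) * x + - y ≡ - (x + y)
      negate = solve-∀
      step : (K : ℕ) → fibDenTail K 0 * h (suc n) + - sumℤ (take (ℕ.pred K ℕ.∸ 1) (applyDownFrom h (suc n)))
                      ≡ - sumℤ (take (K ℕ.∸ 1) (applyDownFrom h (suc (suc n))))
      step zero = refl
      step (suc zero) = refl
      step (suc (suc K)) = negate (h (suc n)) (sumℤ (take K (applyDownFrom h (suc n))))
    fibs≡ : (m : ℕ) → map +_ (fibs B m) ≡ applyDownFrom (fibSeries B) m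
    fibs≡ zero = refl
    fibs≡ (suc m) = cong (+ fib B (suc m) ∷_) (fibs≡ m)
    cancel : ∀ x → + 1 * x + - x ≡ + 0
    cancel = solve-∀
    coefficient : (n : ℕ) → conv (fibDen b) (fibSeries B) n ≡ 𝟙 n
    coefficient zero = refl
    coefficient (suc n) = begin
      + 1 * fibSeries B (suc n) + conv (fibDenTail b) (fibSeries B) n
        ≡⟨ cong (λ z → + 1 * fibSeries B (suc n) + z) (conv-fibDenTail b (fibSeries B) n) ⟩
      + 1 * fibSeries B (suc n) + - sumℤ (take B (applyDownFrom (fibSeries B) (suc n)))
        ≡⟨ cong (λ xs → + 1 * fibSeries B (suc n) + - sumℤ (take B xs)) (sym (fibs≡ (suc n))) ⟩
      + 1 * fibSeries B (suc n) + - sumℤ (take B (map +_ (fibs B (suc n))))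
        ≡⟨ cong (λ z → + 1 * fibSeries B (suc n) + - z)
                (trans (cong sumℤ (take-map B (fibs B (suc n)))) (sumℤ-map-+ (take B (fibs B (suc n))))) ⟩
      + 1 * + sum (take B (fibs B (suc n))) + - + sum (take B (fibs B (suc n)))
        ≡⟨ cancel (+ sum (take B (fibs B (suc n)))) ⟩
      + 0 ∎
      where open ≡-Reasoning

  -- The generating function

  Σˢ : (ℕ → Series) → ℕ → Series
  Σˢ G zero = 0ˢ
  Σˢ G (suc j) = G 0 ⊕ Σˢ (G ∘ suc) j

  Σˢ-vanishing : (G : ℕ → Series) {n : ℕ} → (∀ k → G k n ≡ + 0) → (j : ℕ) → Σˢ G j n ≡ + 0
  Σˢ-vanishing G G≡0 zero = refl
  Σˢ-vanishing G G≡0 (suc j) = trans (cong₂ _+_ (G≡0 0) (Σˢ-vanishing (G ∘ suc) (G≡0 ∘ suc) j)) refl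

  Σˢ-applyUpTo : (G : ℕ → Series) (j n : ℕ) → Σˢ G j n ≡ sumℤ (applyUpTo (λ k → G k n) j)
  Σˢ-applyUpTo G zero n = refl
  Σˢ-applyUpTo G (suc j) n = cong (λ z → G 0 n + z) (Σˢ-applyUpTo (G ∘ suc) j n)

  oneMinusX⊛Σˢ : (G : ℕ → Series) → (∀ k → oneMinusX ⊛ G (suc k) ≐ X^ 1 ⊛ G k) →
    (j : ℕ) → oneMinusX ⊛ Σˢ (G ∘ suc) j ≐ X^ 1 ⊛ Σˢ G j
  oneMinusX⊛Σˢ G shift zero = ≐-trans (⊛-zeroʳ oneMinusX) (≐-sym (⊛-zeroʳ (X^ 1)))
  oneMinusX⊛Σˢ G shift (suc j) = begin
    oneMinusX ⊛ (G 1 ⊕ Σˢ (G ∘ suc ∘ suc) j)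
      ≈⟨ ⊛-distribˡ oneMinusX (G 1) (Σˢ (G ∘ suc ∘ suc) j) ⟩
    (oneMinusX ⊛ G 1) ⊕ (oneMinusX ⊛ Σˢ (G ∘ suc ∘ suc) j)
      ≈⟨ ⊕-cong (shift 0) (oneMinusX⊛Σˢ (G ∘ suc) (shift ∘ suc) j) ⟩
    (X^ 1 ⊛ G 0) ⊕ (X^ 1 ⊛ Σˢ (G ∘ suc) j)
      ≈⟨ ≐-sym (⊛-distribˡ (X^ 1) (G 0) (Σˢ (G ∘ suc) j)) ⟩
    X^ 1 ⊛ (G 0 ⊕ Σˢ (G ∘ suc) j) ∎
    where open ≐-Reasoning

  module GeneratingFunction (b : ℕ) (1≤b : 1 ℕ.≤ b) where

    private
      O = oneMinusX
      X = X^ 1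

    -- For j = a + c this is the generating function of S_n(132, 213, β_{a,b,c}).
    tilingSeries : ℕ → Series
    tilingSeries j = Σˢ binomialSeries j ⊕ (binomialSeries j ⊛ fibSeries (b ℕ.∸ 1))

    denominator : ℕ → Series
    denominator j = (O ^ˢ j) ⊛ fibDen b

    numeratorSum : ℕ → Series
    numeratorSum j = sumSeries (map (λ i → (O ^ˢ i) ⊛ X^ (j ℕ.∸ i ℕ.∸ 1)) (upTo j))

    numerator : ℕ → Series
    numerator j = (O ^ˢ j) ⊕ (X^ b ⊛ numeratorSum j)

    oneMinusX⊛tilingSeries : (j : ℕ) → O ⊛ tilingSeries (suc j) ≐ O ⊕ (X ⊛ tilingSeries j)
    oneMinusX⊛tilingSeries j = begin
      O ⊛ ((𝟙 ⊕ Σˢ (B ∘ suc) j) ⊕ (B (suc j) ⊛ Φ))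
        ≈⟨ ⊛-distribˡ O (𝟙 ⊕ Σˢ (B ∘ suc) j) (B (suc j) ⊛ Φ) ⟩
      (O ⊛ (𝟙 ⊕ Σˢ (B ∘ suc) j)) ⊕ (O ⊛ (B (suc j) ⊛ Φ))
        ≈⟨ ⊕-cong (⊛-distribˡ O 𝟙 (Σˢ (B ∘ suc) j)) (≐-sym (⊛-assoc O (B (suc j)) Φ)) ⟩
      ((O ⊛ 𝟙) ⊕ (O ⊛ Σˢ (B ∘ suc) j)) ⊕ ((O ⊛ B (suc j)) ⊛ Φ)
        ≈⟨ ⊕-cong (⊕-cong (⊛-identityʳ O) (oneMinusX⊛Σˢ B oneMinusX⊛binomialSeries j))
                  (⊛-congˡ Φ (oneMinusX⊛binomialSeries j)) ⟩
      (O ⊕ (X ⊛ Σˢ B j)) ⊕ ((X ⊛ B j) ⊛ Φ)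
        ≈⟨ ⊕-congʳ (O ⊕ (X ⊛ Σˢ B j)) (⊛-assoc X (B j) Φ) ⟩
      (O ⊕ (X ⊛ Σˢ B j)) ⊕ (X ⊛ (B j ⊛ Φ))
        ≈⟨ ⊕-assoc O (X ⊛ Σˢ B j) (X ⊛ (B j ⊛ Φ)) ⟩
      O ⊕ ((X ⊛ Σˢ B j) ⊕ (X ⊛ (B j ⊛ Φ)))
        ≈⟨ ⊕-congʳ O (≐-sym (⊛-distribˡ X (Σˢ B j) (B j ⊛ Φ))) ⟩
      O ⊕ (X ⊛ tilingSeries j) ∎
      where
      open ≐-Reasoning
      B = binomialSeries
      Φ = fibSeries (b ℕ.∸ 1)

    tilingSeries⊛denominator-suc : (j : ℕ) →
      tilingSeries (suc j) ⊛ denominator (suc j) ≐ (O ⊛ denominator j) ⊕ (X ⊛ (tilingSeries j ⊛ denominator j))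
    tilingSeries⊛denominator-suc j = begin
      T (suc j) ⊛ ((O ⊛ (O ^ˢ j)) ⊛ fibDen b)
        ≈⟨ ⊛-congʳ (T (suc j)) (⊛-assoc O (O ^ˢ j) (fibDen b)) ⟩
      T (suc j) ⊛ (O ⊛ denominator j)
        ≈⟨ ≐-sym (⊛-assoc (T (suc j)) O (denominator j)) ⟩
      (T (suc j) ⊛ O) ⊛ denominator j
        ≈⟨ ⊛-congˡ (denominator j) (≐-trans (⊛-comm (T (suc j)) O) (oneMinusX⊛tilingSeries j)) ⟩
      (O ⊕ (X ⊛ T j)) ⊛ denominator j
        ≈⟨ ⊛-distribʳ O (X ⊛ T j) (denominator j) ⟩
      (O ⊛ denominator j) ⊕ ((X ⊛ T j) ⊛ denominator j)
        ≈⟨ ⊕-congʳ (O ⊛ denominator j) (⊛-assoc X (T j) (denominator j)) ⟩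
      (O ⊛ denominator j) ⊕ (X ⊛ (T j ⊛ denominator j)) ∎
      where
      open ≐-Reasoning
      T = tilingSeries

    numeratorSum-suc : (j : ℕ) → numeratorSum (suc j) ≐ X^ j ⊕ (O ⊛ numeratorSum j)
    numeratorSum-suc j = ⊕-cong (⊛-identityˡ (X^ j)) (λ n →
      trans (cong (λ fs → sumSeries fs n) (map-applyUpTo suc (term (suc j)) j))
      (trans (factor-O (O ^ˢ_) (λ i → X^ (j ℕ.∸ i ℕ.∸ 1)) j n)
             (cong (λ fs → (O ⊛ sumSeries fs) n) (sym (map-applyUpTo (λ i → i) (term j) j)))))
      where
      term : ℕ → ℕ → Series
      term j i = (O ^ˢ i) ⊛ X^ (j ℕ.∸ i ℕ.∸ 1)
      factor-O : (F G : ℕ → Series) (j : ℕ) →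
        sumSeries (applyUpTo (λ i → (O ⊛ F i) ⊛ G i) j) ≐ O ⊛ sumSeries (applyUpTo (λ i → F i ⊛ G i) j)
      factor-O F G zero = ≐-sym (⊛-zeroʳ O)
      factor-O F G (suc j) = begin
        ((O ⊛ F 0) ⊛ G 0) ⊕ sumSeries (applyUpTo (λ i → (O ⊛ F (suc i)) ⊛ G (suc i)) j)
          ≈⟨ ⊕-cong (⊛-assoc O (F 0) (G 0)) (factor-O (F ∘ suc) (G ∘ suc) j) ⟩
        (O ⊛ (F 0 ⊛ G 0)) ⊕ (O ⊛ sumSeries (applyUpTo (λ i → F (suc i) ⊛ G (suc i)) j))
          ≈⟨ ≐-sym (⊛-distribˡ O (F 0 ⊛ G 0) (sumSeries (applyUpTo (λ i → F (suc i) ⊛ G (suc i)) j))) ⟩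
        O ⊛ sumSeries (applyUpTo (λ i → F i ⊛ G i) (suc j)) ∎
        where open ≐-Reasoning

    numerator-zero : numerator 0 ≐ 𝟙
    numerator-zero = ≐-trans (⊕-congʳ 𝟙 (⊛-zeroʳ (X^ b))) (⊕-identityʳ 𝟙)

    numerator-step : (j : ℕ) → numerator (suc j) ≐ (O ⊛ numerator j) ⊕ (X^ b ⊛ X^ j)
    numerator-step j = begin
      (O ⊛ (O ^ˢ j)) ⊕ (X^ b ⊛ numeratorSum (suc j))
        ≈⟨ ⊕-congʳ (O ⊛ (O ^ˢ j)) (⊛-congʳ (X^ b) (numeratorSum-suc j)) ⟩
      (O ⊛ (O ^ˢ j)) ⊕ (X^ b ⊛ (X^ j ⊕ (O ⊛ numeratorSum j)))
        ≈⟨ ⊕-congʳ (O ⊛ (O ^ˢ j)) (⊛-distribˡ (X^ b) (X^ j) (O ⊛ numeratorSum j)) ⟩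
      (O ⊛ (O ^ˢ j)) ⊕ ((X^ b ⊛ X^ j) ⊕ (X^ b ⊛ (O ⊛ numeratorSum j)))
        ≈⟨ ⊕-congʳ (O ⊛ (O ^ˢ j)) (⊕-congʳ (X^ b ⊛ X^ j) (⊛-swap (X^ b) O (numeratorSum j))) ⟩
      (O ⊛ (O ^ˢ j)) ⊕ ((X^ b ⊛ X^ j) ⊕ (O ⊛ (X^ b ⊛ numeratorSum j)))
        ≈⟨ (λ n → swap₂₃ ((O ⊛ (O ^ˢ j)) n) ((X^ b ⊛ X^ j) n) ((O ⊛ (X^ b ⊛ numeratorSum j)) n)) ⟩
      ((O ⊛ (O ^ˢ j)) ⊕ (O ⊛ (X^ b ⊛ numeratorSum j))) ⊕ (X^ b ⊛ X^ j)
        ≈⟨ ⊕-congˡ (X^ b ⊛ X^ j) (≐-sym (⊛-distribˡ O (O ^ˢ j) (X^ b ⊛ numeratorSum j))) ⟩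
      (O ⊛ numerator j) ⊕ (X^ b ⊛ X^ j) ∎
      where
      open ≐-Reasoning
      swap₂₃ : ∀ x y z → x + (y + z) ≡ (x + z) + y
      swap₂₃ = solve-∀

    numerator-suc : (j : ℕ) → numerator (suc j) ≐ (X ⊛ numerator j) ⊕ (O ⊛ denominator j)
    numerator-suc zero = begin
      numerator 1
        ≈⟨ numerator-step 0 ⟩
      (O ⊛ numerator 0) ⊕ (X^ b ⊛ X^ 0)
        ≈⟨ ⊕-cong (≐-trans (⊛-congʳ O numerator-zero) (⊛-identityʳ O))
                  (≐-trans (⊛-congʳ (X^ b) X^0≐𝟙) (⊛-identityʳ (X^ b))) ⟩
      O ⊕ X^ b
        ≈⟨ ≐-sym (oneMinusX⊛fibDen b 1≤b) ⟩
      (O ⊛ fibDen b) ⊕ X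
        ≈⟨ ⊕-comm (O ⊛ fibDen b) X ⟩
      X ⊕ (O ⊛ fibDen b)
        ≈⟨ ⊕-cong (≐-sym (≐-trans (⊛-congʳ X numerator-zero) (⊛-identityʳ X)))
                  (⊛-congʳ O (≐-sym (⊛-identityˡ (fibDen b)))) ⟩
      (X ⊛ numerator 0) ⊕ (O ⊛ denominator 0) ∎
      where open ≐-Reasoning
    numerator-suc (suc j) = begin
      numerator (suc (suc j))
        ≈⟨ numerator-step (suc j) ⟩
      (O ⊛ numerator (suc j)) ⊕ (X^ b ⊛ X^ (suc j))
        ≈⟨ ⊕-cong (⊛-congʳ O (numerator-suc j)) (⊛-congʳ (X^ b) (X^-suc j)) ⟩
      (O ⊛ ((X ⊛ numerator j) ⊕ (O ⊛ denominator j))) ⊕ (X^ b ⊛ (X ⊛ X^ j))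
        ≈⟨ ⊕-cong (⊛-distribˡ O (X ⊛ numerator j) (O ⊛ denominator j)) (⊛-swap (X^ b) X (X^ j)) ⟩
      ((O ⊛ (X ⊛ numerator j)) ⊕ (O ⊛ (O ⊛ denominator j))) ⊕ (X ⊛ (X^ b ⊛ X^ j))
        ≈⟨ ⊕-congˡ (X ⊛ (X^ b ⊛ X^ j)) (⊕-cong (⊛-swap O X (numerator j))
                                                (⊛-congʳ O (≐-sym (⊛-assoc O (O ^ˢ j) (fibDen b))))) ⟩
      ((X ⊛ (O ⊛ numerator j)) ⊕ (O ⊛ denominator (suc j))) ⊕ (X ⊛ (X^ b ⊛ X^ j))
        ≈⟨ (λ n → swap₂₃ ((X ⊛ (O ⊛ numerator j)) n) ((O ⊛ denominator (suc j)) n) ((X ⊛ (X^ b ⊛ X^ j)) n)) ⟩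
      ((X ⊛ (O ⊛ numerator j)) ⊕ (X ⊛ (X^ b ⊛ X^ j))) ⊕ (O ⊛ denominator (suc j))
        ≈⟨ ⊕-congˡ (O ⊛ denominator (suc j))
                   (≐-trans (≐-sym (⊛-distribˡ X (O ⊛ numerator j) (X^ b ⊛ X^ j)))
                            (⊛-congʳ X (≐-sym (numerator-step j)))) ⟩
      (X ⊛ numerator (suc j)) ⊕ (O ⊛ denominator (suc j)) ∎
      where
      open ≐-Reasoning
      swap₂₃ : ∀ x y z → (x + y) + z ≡ (x + z) + y
      swap₂₃ = solve-∀

    tilingSeries⊛denominator : (j : ℕ) → tilingSeries j ⊛ denominator j ≐ numerator j
    tilingSeries⊛denominator zero = begin
      tilingSeries 0 ⊛ (𝟙 ⊛ fibDen b)
        ≈⟨ ⊛-cong (λ n → ℤ.+-identityˡ ((𝟙 ⊛ Φ) n)) (⊛-identityˡ (fibDen b)) ⟩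
      (𝟙 ⊛ Φ) ⊛ fibDen b
        ≈⟨ ⊛-congˡ (fibDen b) (⊛-identityˡ Φ) ⟩
      Φ ⊛ fibDen b
        ≈⟨ fibSeries⊛fibDen b ⟩
      𝟙
        ≈⟨ ≐-sym numerator-zero ⟩
      numerator 0 ∎
      where
      open ≐-Reasoning
      Φ = fibSeries (b ℕ.∸ 1)
    tilingSeries⊛denominator (suc j) = begin
      tilingSeries (suc j) ⊛ denominator (suc j)
        ≈⟨ tilingSeries⊛denominator-suc j ⟩
      (O ⊛ denominator j) ⊕ (X ⊛ (tilingSeries j ⊛ denominator j))
        ≈⟨ ⊕-congʳ (O ⊛ denominator j) (⊛-congʳ X (tilingSeries⊛denominator j)) ⟩
      (O ⊛ denominator j) ⊕ (X ⊛ numerator j)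
        ≈⟨ ⊕-comm (O ⊛ denominator j) (X ⊛ numerator j) ⟩
      (X ⊛ numerator j) ⊕ (O ⊛ denominator j)
        ≈⟨ ≐-sym (numerator-suc j) ⟩
      numerator (suc j) ∎
      where open ≐-Reasoning

    -- countFormula a b c = countFormulaᵈ (a + c)
    countFormulaᵈ : ℕ → ℕ → ℕ
    countFormulaᵈ d n = sumRange 1 (d ℕ.∸ 1) (λ k → (n ℕ.∸ 1) C (k ℕ.∸ 1))
      ℕ.+ sumRange d n (λ k → ((k ℕ.∸ 1) C (d ℕ.∸ 1)) ℕ.* fib (b ℕ.∸ 1) (n ℕ.∸ k ℕ.+ 1))

    tilingSeries-coefficients : (d : ℕ) → 1 ℕ.≤ d → (f : ℕ → ℕ) → f 0 ≡ 1 →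
      (∀ n → f (suc n) ≡ countFormulaᵈ d (suc n)) → (λ m → + f m) ≐ tilingSeries d
    tilingSeries-coefficients (suc d) _ f f0≡1 _ zero =
      trans (cong +_ f0≡1)
            (sym (cong (λ z → + 1 + z + + 0) (Σˢ-vanishing (binomialSeries ∘ suc) (λ _ → refl) d)))
    tilingSeries-coefficients (suc d) _ f _ f≡ (suc n) =
      trans (cong +_ (f≡ n)) (trans (ℤ.pos-+ (sumRange 1 d (λ k → n C (k ℕ.∸ 1))) _)
                                     (cong₂ _+_ compositions-part fibonacci-part))
      where
      Φ = fibSeries (b ℕ.∸ 1)
      compositions-part : + sumRange 1 d (λ k → n C (k ℕ.∸ 1)) ≡ Σˢ binomialSeries (suc d) (suc n)
      compositions-part = begin
        + sum (map (n C_) (upTo d))           ≡⟨ cong (+_ ∘ sum) (map-upTo (n C_) d) ⟩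
        + sum (applyUpTo (n C_) d)            ≡⟨ +-sum-applyUpTo (n C_) d ⟩
        sumℤ (applyUpTo (λ k → + (n C k)) d)  ≡⟨ sym (Σˢ-applyUpTo (binomialSeries ∘ suc) d (suc n)) ⟩
        Σˢ (binomialSeries ∘ suc) d (suc n)   ≡⟨ sym (ℤ.+-identityˡ _) ⟩
        Σˢ binomialSeries (suc d) (suc n)     ∎
        where open ≡-Reasoning
      term : ℕ → ℤ
      term k = binomialSeries (suc d) k * Φ (suc n ℕ.∸ k)
      term-vanishes : ∀ k → k ℕ.< suc d → term k ≡ + 0
      term-vanishes zero _ = refl
      term-vanishes (suc k) (ℕ.s≤s k<d) = cong (λ z → + z * Φ (suc n ℕ.∸ suc k)) (k>n⇒nCk≡0 k<d)
      fibonacci-part : + sumRange (suc d) (suc n) (λ k → ((k ℕ.∸ 1) C d) ℕ.* fib (b ℕ.∸ 1) (suc n ℕ.∸ k ℕ.+ 1))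
                       ≡ (binomialSeries (suc d) ⊛ Φ) (suc n)
      summand : ℕ → ℕ
      summand i = ((d ℕ.+ i) C d) ℕ.* fib (b ℕ.∸ 1) (suc n ℕ.∸ suc (d ℕ.+ i) ℕ.+ 1)
      fibonacci-part = begin
        + sum (map summand (upTo (suc n ℕ.∸ d)))            ≡⟨ cong (+_ ∘ sum) (map-upTo summand (suc n ℕ.∸ d)) ⟩
        + sum (applyUpTo summand (suc n ℕ.∸ d))             ≡⟨ +-sum-applyUpTo summand (suc n ℕ.∸ d) ⟩
        sumℤ (applyUpTo (+_ ∘ summand) (suc n ℕ.∸ d))
          ≡⟨ cong sumℤ (applyUpTo-cong (λ i → trans (ℤ.pos-* ((d ℕ.+ i) C d) _)
                                                    (cong (λ z → + ((d ℕ.+ i) C d) * + fib (b ℕ.∸ 1) z)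
                                                          (ℕ.+-comm _ 1))) (suc n ℕ.∸ d)) ⟩
        sumℤ (applyUpTo (λ i → term (suc d ℕ.+ i)) (suc (suc n) ℕ.∸ suc d))
          ≡⟨ sym (sumℤ-applyUpTo-drop (suc d) term (suc (suc n)) term-vanishes) ⟩
        sumℤ (applyUpTo term (suc (suc n)))
          ≡⟨ sym (⊛-applyUpTo (binomialSeries (suc d)) Φ (suc n)) ⟩
        (binomialSeries (suc d) ⊛ Φ) (suc n) ∎
        where open ≡-Reasoning

    counting-series⊛gfDenominator : (a c : ℕ) → 1 ℕ.≤ a ℕ.+ c → (f : ℕ → ℕ) → f 0 ≡ 1 →
      (∀ n → f (suc n) ≡ countFormula a b c (suc n)) →
      (λ m → + f m) ⊛ gfDenominator a b c ≐ gfNumerator a b c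
    counting-series⊛gfDenominator a c 1≤a+c f f0≡1 f≡ =
      ≐-trans (⊛-congˡ (gfDenominator a b c) (tilingSeries-coefficients (a ℕ.+ c) 1≤a+c f f0≡1 f≡))
              (tilingSeries⊛denominator (a ℕ.+ c))

open import Defs
open import Data.Nat using (ℕ; _+_; _≤_; suc; s≤s; z≤n)
open import Data.Integer using (+_)
open import Data.List using (List; []; _∷_)
open import Data.Product using (_×_; ∃; _,_)
open import Relation.Binary.PropositionalEquality using (_≡_)
open LayeredPermutations
  using (𝓕∈RestrictedTiling; 𝓕-injective; 𝓕-surjective; S-hasCard; S₀-hasCard; HasCard-unique)
open PowerSeries using (module GeneratingFunction)

mainTheorem1 : (a b c : ℕ) → 1 ≤ a + c → 1 ≤ b →
    let R = p132 ∷ p213 ∷ β a b c ∷ [] in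
    ((n : ℕ) →
        ((π : List ℕ) → S n R π → Tiling n (𝓕 π) × Restricted a b c (𝓕 π))
      × ((π π′ : List ℕ) → S n R π → S n R π′ → 𝓕 π ≡ 𝓕 π′ → π ≡ π′)
      × ((t : List ℕ) → Tiling n t → Restricted a b c t → ∃ λ π → S n R π × 𝓕 π ≡ t))
    × ((n : ℕ) → 1 ≤ n → HasCard (S n R) (countFormula a b c n))
    × ((f : ℕ → ℕ) → ((n : ℕ) → HasCard (S n R) (f n)) →
        (n : ℕ) → ((λ m → + f m) ⊛ gfDenominator a b c) n ≡ gfNumerator a b c n)
mainTheorem1 a b c 1≤a+c 1≤b =
  (λ n → (λ π → 𝓕∈RestrictedTiling a b c) ,
         (λ π π′ → 𝓕-injective a b c) ,
         (λ t tiling restricted → 𝓕-surjective a b c 1≤b (tiling , restricted))) ,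
  (λ n → S-hasCard a b c n 1≤a+c 1≤b) ,
  (λ f card → counting-series⊛gfDenominator a c 1≤a+c f
                (HasCard-unique (card 0) (S₀-hasCard a b c 1≤b))
                (λ n → HasCard-unique (card (suc n)) (S-hasCard a b c (suc n) 1≤a+c 1≤b (s≤s z≤n))))
  where open GeneratingFunction b 1≤b using (counting-series⊛gfDenominator)
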